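{- Let $q$ be a power of an odd prime, $k\ge1$, $S=\{x\in\mathbb F_q^d:\|x\|=1\}$ and $E\subset S$. For $y^1,\dots,y^k\in\mathbb F_q^d$ and $s_1,\dots,s_k\in\mathbb F_q$ let $$\nu_{y^1,\dots,y^k}(s_1,\dots,s_k)=|\{x\in E:\|x-y^1\|=s_1,\dots,\|x-y^k\|=s_k\}|.$$ Then $$\sum_{y^1,\dots,y^k\in E}\ \sum_{s_1,\dots,s_k\in\mathbb F_q}\nu_{y^1,\dots,y^k}(s_1,\dots,s_k)^2\lesssim\frac{|E|^{k+2}}{q^k}+q^{d-1}|E|^k.$$
   Context: $\|x\|=x_1^2+\dots+x_d^2$. $X\lesssim Y$ means $X\le CY$ with $C>0$ independent of $q$ and $E$ (possibly depending on $k$). -}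

module Defs where

open import Level using (0ℓ)
open import Data.Bool using (Bool; T)
open import Data.Nat as ℕ using (ℕ)
open import Data.Fin using (Fin; zero; suc)
open import Data.Fin.Properties using (all?)
open import Data.List using (List; []; _∷_; map; concatMap; filter; filterᵇ; length; allFin)
open import Data.Nat.ListAction using (sum)
import Data.Vec.Functional as VF
open import Data.Product using (Σ; ∃)
open import Relation.Nullary using (¬_; Dec)
open import Relation.Binary.PropositionalEquality using (_≡_)
open import Algebra.Structures using (IsCommutativeRing)
open import Function.Bundles using (_↔_; Inverse)

record FiniteField : Set₁ where
  infixl 6 _+_ _-_
  infixl 7 _*_
  field
    Carrier : Set
    _+_ _*_ : Carrier → Carrier → Carrier
    -_      : Carrier → Carrier
    0# 1#   : Carrier
    isCommutativeRing : IsCommutativeRing _≡_ _+_ _*_ -_ 0# 1#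
    _≟_     : (x y : Carrier) → Dec (x ≡ y)
    0≢1     : ¬ (0# ≡ 1#)
    inverse : ∀ x → ¬ (x ≡ 0#) → ∃ λ y → x * y ≡ 1#
    size    : ℕ
    enum    : Fin size ↔ Carrier

  _-_ : Carrier → Carrier → Carrier
  x - y = x + (- y)

  elements : List Carrier
  elements = map (Inverse.to enum) (allFin size)

-- q is odd, i.e. the characteristic is not 2
OddChar : FiniteField → Set
OddChar F = ¬ (1# + 1# ≡ 0#) where open FiniteField F

allFuns : {A : Set} → List A → (n : ℕ) → List (Fin n → A)
allFuns xs ℕ.zero    = (λ ()) ∷ []
allFuns xs (ℕ.suc n) = concatMap (λ a → map (λ v → a VF.∷ v) (allFuns xs n)) xs

module _ (F : FiniteField) where
  open FiniteField F

  Pt : ℕ → Set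
  Pt d = Fin d → Carrier

  ‖_‖ : ∀ {d} → Pt d → Carrier
  ‖ x ‖ = VF.foldr _+_ 0# (λ i → x i * x i)

  _-ᵥ_ : ∀ {d} → Pt d → Pt d → Pt d
  (x -ᵥ y) i = x i - y i

  space : (d : ℕ) → List (Pt d)
  space d = allFuns elements d

  elemsOf : ∀ {d} → (Pt d → Bool) → List (Pt d)
  elemsOf {d} E = filterᵇ E (space d)

  card : ∀ {d} → (Pt d → Bool) → ℕ
  card E = length (elemsOf E)

  ν : ∀ {d k} → (Pt d → Bool) → (Fin k → Pt d) → (Fin k → Carrier) → ℕ
  ν E ys s = length (filter (λ x → all? (λ j → ‖ x -ᵥ ys j ‖ ≟ s j)) (elemsOf E))

  energy : ∀ {d} → (k : ℕ) → (Pt d → Bool) → ℕ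
  energy k E = sum (map (λ ys → sum (map (λ s → ν E ys s ℕ.* ν E ys s)
                                          (allFuns elements k)))
                        (allFuns (elemsOf E) k))

-- Let N(x, x′) = #{y ∈ E : x·y = x′·y}. On the unit sphere in odd characteristic
-- ‖x - y‖ = ‖x′ - y‖ iff x·y = x′·y, so the energy is Σ_{x,x′ ∈ E} N(x, x′)^k.
-- With φ_w(x, x′) = q [(x - x′)·w = 0] - 1 we have D := q N - |E| = Σ_{y ∈ E} φ_y, and
-- (q N)^k ≤ 2^k (|E|^k + (q |E|)^(k-2) D²) reduces the claim to Σ_{x,x′} D² ≤ 2 (q-1) q^d |E|²
-- (for k = 1, to Σ_{x,x′} D ≤ 2 q^d |E|). Put G(w) = Σ_{x,x′ ∈ E} φ_w(x, x′). Then G ≥ 0 by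
-- Cauchy–Schwarz, Σ_{w ∈ F_q^d} G(w) = (q-1) q^d |E|, G(t w) = G(w) for t ≠ 0, and
-- (q-1) φ_y φ_{y′} = Σ_{s,t ≠ 0} φ_{s y + t y′}. So (q-1) Σ_{y ∈ E} G(y) and (q-1) Σ_{x,x′} D²
-- are weighted sums of G over lines and planes through the origin spanned by points of E, with
-- multiplicities controlled because a line through the origin meets the sphere at most twice.

module Submission where

open import Defs
open import Level using (0ℓ)
open import Data.Nat as ℕ using (ℕ; zero; suc)
import Data.Nat.Properties as ℕP
open import Data.Nat.ListAction using (sum)
open import Data.Integer as ℤ using (ℤ; +_; -[1+_]; 0ℤ; 1ℤ; _+_; _*_; -_; _-_; _≤_; +≤+; ∣_∣; _^_)
import Data.Integer.Properties as ZP
open import Data.Integer.Tactic.RingSolver using (solve-∀)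
open import Data.Bool using (Bool; T; T?)
open import Data.Product using (∃; _×_; _,_; proj₁; proj₂; uncurry)
open import Data.Sum using (_⊎_; inj₁; inj₂)
open import Data.Empty using (⊥-elim)
open import Data.Fin using (Fin) renaming (zero to fz; suc to fs)
import Data.Fin.Properties as FinP
open import Data.Fin.Properties using (all?)
open import Data.List using (List; []; _∷_; map; concatMap; filter; length; allFin; _++_; tabulate)
import Data.List.Properties as ListP
open import Data.List.Relation.Unary.All as All using (All; []; _∷_)
open import Data.List.Relation.Unary.All.Properties using (all-filter)
import Data.Vec.Functional as VF
import Data.Vec.Functional.Relation.Binary.Pointwise.Properties as PW
open import Relation.Nullary using (¬_; Dec; yes; no)
open import Relation.Nullary.Decidable using (¬?; _×-dec_)
open import Relation.Binary.Bundles using (DecSetoid)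
open import Algebra.Bundles using (CommutativeRing)
open import Algebra.Structures using (IsCommutativeRing)
import Algebra.Solver.Ring.AlmostCommutativeRing as ACR
import Algebra.Properties.Semiring.Mult as SemiringMult
import Data.Sign.Base as Sign
open import Data.Maybe using (Maybe; just; nothing)
import Relation.Binary.PropositionalEquality.Properties as ≡
open import Relation.Binary.PropositionalEquality
  using (_≡_; refl; sym; trans; cong; cong₂; subst; subst₂; module ≡-Reasoning)
open import Function using (_∘_; id)
open import Function.Bundles using (Inverse)

*-monoˡ-≤-0≤ : ∀ {c a b} → 0ℤ ≤ c → a ≤ b → c * a ≤ c * b
*-monoˡ-≤-0≤ {c} 0≤c = ZP.*-monoˡ-≤-nonNeg c {{ℤ.nonNegative 0≤c}}

*-monoʳ-≤-0≤ : ∀ {c a b} → 0ℤ ≤ c → a ≤ b → a * c ≤ b * c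
*-monoʳ-≤-0≤ {c} 0≤c = ZP.*-monoʳ-≤-nonNeg c {{ℤ.nonNegative 0≤c}}

*-cancelˡ-≤-1≤ : ∀ {c a b} → 1ℤ ≤ c → c * a ≤ c * b → a ≤ b
*-cancelˡ-≤-1≤ {+ suc n} {a} {b} _ = ZP.*-cancelˡ-≤-pos a b (+ suc n)
*-cancelˡ-≤-1≤ {+ zero} (+≤+ ())

0≤+ : ∀ n → 0ℤ ≤ + n
0≤+ n = +≤+ ℕ.z≤n

0≤-* : ∀ {a b} → 0ℤ ≤ a → 0ℤ ≤ b → 0ℤ ≤ a * b
0≤-* {a} 0≤a 0≤b = subst₂ _≤_ (ZP.*-zeroʳ a) refl (*-monoˡ-≤-0≤ 0≤a 0≤b)

0≤-^ : ∀ {a} → 0ℤ ≤ a → ∀ k → 0ℤ ≤ a ^ k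
0≤-^ 0≤a zero    = 0≤+ 1
0≤-^ 0≤a (suc k) = 0≤-* 0≤a (0≤-^ 0≤a k)

0≤-sq : ∀ i → 0ℤ ≤ i * i
0≤-sq (+ n)    = 0≤-* (0≤+ n) (0≤+ n)
0≤-sq -[1+ n ] = 0≤+ _

≤-+-nonnegʳ : ∀ {a b c} → 0ℤ ≤ c → a ≤ b → a ≤ b + c
≤-+-nonnegʳ 0≤c a≤b = subst₂ _≤_ (ZP.+-identityʳ _) refl (ZP.+-mono-≤ a≤b 0≤c)

≤-+-nonnegˡ : ∀ {a b c} → 0ℤ ≤ c → a ≤ b → a ≤ c + b
≤-+-nonnegˡ 0≤c a≤b = subst₂ _≤_ (ZP.+-identityˡ _) refl (ZP.+-mono-≤ 0≤c a≤b)

≤-drop-nonnegˡ : ∀ {a b c} → 0ℤ ≤ a → a + b ≤ c → b ≤ c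
≤-drop-nonnegˡ 0≤a a+b≤c = ZP.≤-trans (≤-+-nonnegˡ 0≤a ZP.≤-refl) a+b≤c

^-monoˡ-≤ : ∀ {x y} → 0ℤ ≤ x → x ≤ y → ∀ k → x ^ k ≤ y ^ k
^-monoˡ-≤ 0≤x x≤y zero    = ZP.≤-refl
^-monoˡ-≤ 0≤x x≤y (suc k) =
  ZP.≤-trans (*-monoʳ-≤-0≤ (0≤-^ 0≤x k) x≤y)
             (*-monoˡ-≤-0≤ (ZP.≤-trans 0≤x x≤y) (^-monoˡ-≤ 0≤x x≤y k))

^-monoʳ-≤ : ∀ {x} → 1ℤ ≤ x → ∀ {i j} → i ℕ.≤ j → x ^ i ≤ x ^ j
^-monoʳ-≤ {x} 1≤x {j = j} ℕ.z≤n = go j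
  where
  0≤x : 0ℤ ≤ x
  0≤x = ZP.≤-trans (0≤+ 1) 1≤x
  go : ∀ j → 1ℤ ≤ x ^ j
  go zero    = ZP.≤-refl
  go (suc j) = subst₂ _≤_ (ZP.*-identityˡ 1ℤ) refl
                 (ZP.≤-trans (*-monoʳ-≤-0≤ (0≤+ 1) 1≤x) (*-monoˡ-≤-0≤ 0≤x (go j)))
^-monoʳ-≤ {x} 1≤x (ℕ.s≤s i≤j) = *-monoˡ-≤-0≤ (ZP.≤-trans (0≤+ 1) 1≤x) (^-monoʳ-≤ 1≤x i≤j)

^-distribʳ-* : ∀ x y k → (x * y) ^ k ≡ x ^ k * y ^ k
^-distribʳ-* x y zero    = refl
^-distribʳ-* x y (suc k) = trans (cong ((x * y) *_) (^-distribʳ-* x y k)) (interchange x y (x ^ k) (y ^ k))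
  where
  interchange : ∀ a b c e → a * b * (c * e) ≡ a * c * (b * e)
  interchange = solve-∀

pos-^ : ∀ m k → + (m ℕ.^ k) ≡ (+ m) ^ k
pos-^ m zero    = refl
pos-^ m (suc k) = trans (ZP.pos-* m (m ℕ.^ k)) (cong (+ m *_) (pos-^ m k))

pos-2^[k+1]*[m^[k+2]+s^e*m^k] : ∀ k m s e →
  + (2 ℕ.^ (k ℕ.+ 1) ℕ.* (m ℕ.^ (k ℕ.+ 2) ℕ.+ s ℕ.^ e ℕ.* m ℕ.^ k))
    ≡ (+ 2) ^ suc k * ((+ m) ^ (k ℕ.+ 2) + (+ s) ^ e * (+ m) ^ k)
pos-2^[k+1]*[m^[k+2]+s^e*m^k] k m s e =
  trans (ZP.pos-* (2 ℕ.^ (k ℕ.+ 1)) _)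
    (cong₂ _*_ (trans (pos-^ 2 (k ℕ.+ 1)) (cong ((+ 2) ^_) (ℕP.+-comm k 1)))
               (trans (ZP.pos-+ (m ℕ.^ (k ℕ.+ 2)) _)
                 (cong₂ _+_ (pos-^ m (k ℕ.+ 2))
                   (trans (ZP.pos-* (s ℕ.^ e) _) (cong₂ _*_ (pos-^ s e) (pos-^ m k))))))

-- Either a ≤ 2b, and a^(j+2) ≤ (2b)^(j+2); or 2b ≤ a, and then b ≤ a - b ≤ Q b gives
-- a^(j+2) ≤ (2(a - b))^(j+2) ≤ 2^(j+2) (Q b)^j (a - b)².
^-≤-split : ∀ (a b Q : ℤ) (j : ℕ) → 0ℤ ≤ a → 0ℤ ≤ b → 0ℤ ≤ Q → a ≤ Q * b →
  a ^ (2 ℕ.+ j) ≤ (+ 2) ^ (2 ℕ.+ j) * (b ^ (2 ℕ.+ j) + (Q * b) ^ j * ((a - b) * (a - b)))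
^-≤-split a b Q j 0≤a 0≤b 0≤Q a≤Qb with ZP.≤-total a (+ 2 * b)
... | inj₁ a≤2b = ZP.≤-trans (^-monoˡ-≤ 0≤a a≤2b k)
                    (subst₂ _≤_ (sym (^-distribʳ-* (+ 2) b k)) refl
                      (*-monoˡ-≤-0≤ (0≤-^ (0≤+ 2) k) (≤-+-nonnegʳ rest-nonneg ZP.≤-refl)))
  where
  k = 2 ℕ.+ j
  rest-nonneg : 0ℤ ≤ (Q * b) ^ j * ((a - b) * (a - b))
  rest-nonneg = 0≤-* (0≤-^ (0≤-* 0≤Q 0≤b) j) (0≤-sq (a - b))
... | inj₂ 2b≤a = ZP.≤-trans (^-monoˡ-≤ 0≤a a≤2e k)
                    (subst₂ _≤_ (sym (^-distribʳ-* (+ 2) e k)) refl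
                      (*-monoˡ-≤-0≤ (0≤-^ (0≤+ 2) k) (≤-+-nonnegˡ (0≤-^ 0≤b k) e^k≤)))
  where
  k = 2 ℕ.+ j
  e = a - b
  b≤e : b ≤ e
  b≤e = subst₂ _≤_ (2b-b≡b b) refl (ZP.+-mono-≤ 2b≤a (ZP.≤-refl { - b}))
    where
    2b-b≡b : ∀ b → + 2 * b - b ≡ b
    2b-b≡b = solve-∀
  0≤e : 0ℤ ≤ e
  0≤e = ZP.≤-trans 0≤b b≤e
  e≤Qb : e ≤ Q * b
  e≤Qb = ZP.≤-trans (subst₂ _≤_ refl (ZP.+-identityʳ a) (ZP.+-mono-≤ (ZP.≤-refl {a}) (ZP.neg-mono-≤ 0≤b))) a≤Qb
  a≤2e : a ≤ + 2 * e
  a≤2e = subst₂ _≤_ (b+[a-b]≡a a b) (e+e≡2e e) (ZP.+-mono-≤ b≤e (ZP.≤-refl {e}))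
    where
    b+[a-b]≡a : ∀ a b → b + (a - b) ≡ a
    b+[a-b]≡a = solve-∀
    e+e≡2e : ∀ e → e + e ≡ + 2 * e
    e+e≡2e = solve-∀
  e^k≤ : e ^ k ≤ (Q * b) ^ j * (e * e)
  e^k≤ = subst₂ _≤_ (reorder e (e ^ j)) refl (*-monoʳ-≤-0≤ (0≤-sq e) (^-monoˡ-≤ 0≤e e≤Qb j))
    where
    reorder : ∀ e p → p * (e * e) ≡ e * (e * p)
    reorder = solve-∀

-- With truncated subtraction this is strict at d = 0, where d ∸ 1 = 0.
+-≤-∸1+suc : ∀ d m → d ℕ.+ m ℕ.≤ (d ℕ.∸ 1) ℕ.+ suc m
+-≤-∸1+suc zero    m = ℕP.n≤1+n m
+-≤-∸1+suc (suc d) m = ℕP.≤-reflexive (sym (ℕP.+-suc d m))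

χ : ∀ {P : Set} → Dec P → ℤ
χ (yes _) = 1ℤ
χ (no _)  = 0ℤ

χ-⇔ : ∀ {P Q : Set} (p : Dec P) (q : Dec Q) → (P → Q) → (Q → P) → χ p ≡ χ q
χ-⇔ (yes _) (yes _) f g = refl
χ-⇔ (yes p) (no ¬q) f g = ⊥-elim (¬q (f p))
χ-⇔ (no ¬p) (yes q) f g = ⊥-elim (¬p (g q))
χ-⇔ (no _)  (no _)  f g = refl

χ-yes : ∀ {P : Set} (p : Dec P) → P → χ p ≡ 1ℤ
χ-yes (yes _) _ = refl
χ-yes (no ¬p) p = ⊥-elim (¬p p)

χ-no : ∀ {P : Set} (p : Dec P) → ¬ P → χ p ≡ 0ℤ
χ-no (yes p) ¬p = ⊥-elim (¬p p)
χ-no (no _)  _  = refl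

0≤χ : ∀ {P : Set} (p : Dec P) → 0ℤ ≤ χ p
0≤χ (yes _) = 0≤+ 1
0≤χ (no _)  = 0≤+ 0

χ≤1 : ∀ {P : Set} (p : Dec P) → χ p ≤ 1ℤ
χ≤1 (yes _) = +≤+ (ℕ.s≤s ℕ.z≤n)
χ≤1 (no _)  = +≤+ ℕ.z≤n

χ-× : ∀ {P Q : Set} (p : Dec P) (q : Dec Q) → χ p * χ q ≡ χ (p ×-dec q)
χ-× (yes _) (yes _) = refl
χ-× (yes _) (no _)  = refl
χ-× (no _)  (yes _) = refl
χ-× (no _)  (no _)  = refl

χ-¬ : ∀ {P : Set} (p : Dec P) → χ (¬? p) ≡ 1ℤ - χ p
χ-¬ (yes _) = refl
χ-¬ (no _)  = refl

χ-mono : ∀ {P Q : Set} (p : Dec P) (q : Dec Q) → (P → Q) → χ p ≤ χ q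
χ-mono (yes p) q f = ZP.≤-reflexive (sym (χ-yes q (f p)))
χ-mono (no _)  q f = 0≤χ q

Σ : ∀ {A : Set} → List A → (A → ℤ) → ℤ
Σ []       f = 0ℤ
Σ (x ∷ xs) f = f x + Σ xs f

module _ {A : Set} where

  Σ-cong : ∀ (xs : List A) {f g : A → ℤ} → (∀ x → f x ≡ g x) → Σ xs f ≡ Σ xs g
  Σ-cong []       e = refl
  Σ-cong (x ∷ xs) e = cong₂ _+_ (e x) (Σ-cong xs e)

  Σ-congᴬ : ∀ {P : A → Set} (xs : List A) {f g : A → ℤ} →
            All P xs → (∀ x → P x → f x ≡ g x) → Σ xs f ≡ Σ xs g
  Σ-congᴬ []       _          e = refl
  Σ-congᴬ (x ∷ xs) (px ∷ pxs) e = cong₂ _+_ (e x px) (Σ-congᴬ xs pxs e)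

  Σ-mono : ∀ (xs : List A) {f g : A → ℤ} → (∀ x → f x ≤ g x) → Σ xs f ≤ Σ xs g
  Σ-mono []       e = ZP.≤-refl
  Σ-mono (x ∷ xs) e = ZP.+-mono-≤ (e x) (Σ-mono xs e)

  Σ-zero : ∀ (xs : List A) → Σ xs (λ _ → 0ℤ) ≡ 0ℤ
  Σ-zero []       = refl
  Σ-zero (x ∷ xs) = trans (ZP.+-identityˡ _) (Σ-zero xs)

  0≤Σ : ∀ (xs : List A) {f : A → ℤ} → (∀ x → 0ℤ ≤ f x) → 0ℤ ≤ Σ xs f
  0≤Σ xs e = subst₂ _≤_ (Σ-zero xs) refl (Σ-mono xs e)

  Σ-+ : ∀ (xs : List A) (f g : A → ℤ) → Σ xs (λ x → f x + g x) ≡ Σ xs f + Σ xs g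
  Σ-+ []       f g = refl
  Σ-+ (x ∷ xs) f g = trans (cong (_+_ (f x + g x)) (Σ-+ xs f g)) (lemma (f x) (g x) (Σ xs f) (Σ xs g))
    where
    lemma : ∀ a b c d → a + b + (c + d) ≡ a + c + (b + d)
    lemma = solve-∀

  Σ-*ˡ : ∀ (xs : List A) (c : ℤ) (f : A → ℤ) → Σ xs (λ x → c * f x) ≡ c * Σ xs f
  Σ-*ˡ []       c f = sym (ZP.*-zeroʳ c)
  Σ-*ˡ (x ∷ xs) c f = trans (cong (_+_ (c * f x)) (Σ-*ˡ xs c f)) (sym (ZP.*-distribˡ-+ c (f x) (Σ xs f)))

  Σ-*ʳ : ∀ (xs : List A) (c : ℤ) (f : A → ℤ) → Σ xs (λ x → f x * c) ≡ Σ xs f * c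
  Σ-*ʳ xs c f = trans (Σ-cong xs (λ x → ZP.*-comm (f x) c)) (trans (Σ-*ˡ xs c f) (ZP.*-comm c _))

  Σ-neg : ∀ (xs : List A) (f : A → ℤ) → Σ xs (λ x → - f x) ≡ - Σ xs f
  Σ-neg []       f = refl
  Σ-neg (x ∷ xs) f = trans (cong (_+_ (- f x)) (Σ-neg xs f)) (sym (ZP.neg-distrib-+ (f x) (Σ xs f)))

  Σ-- : ∀ (xs : List A) (f g : A → ℤ) → Σ xs (λ x → f x - g x) ≡ Σ xs f - Σ xs g
  Σ-- xs f g = trans (Σ-+ xs f (λ x → - g x)) (cong (_+_ (Σ xs f)) (Σ-neg xs g))

  Σ-const : ∀ (xs : List A) (c : ℤ) → Σ xs (λ _ → c) ≡ + length xs * c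
  Σ-const []       c = sym (ZP.*-zeroˡ c)
  Σ-const (x ∷ xs) c = trans (cong (_+_ c) (Σ-const xs c)) (lemma (+ length xs) c)
    where
    lemma : ∀ n c → c + n * c ≡ (1ℤ + n) * c
    lemma = solve-∀

  Σ-const-* : ∀ (xs : List A) (c : ℤ) → Σ xs (λ _ → c) ≡ c * Σ xs (λ _ → 1ℤ)
  Σ-const-* xs c = trans (Σ-cong xs (λ _ → sym (ZP.*-identityʳ c))) (Σ-*ˡ xs c (λ _ → 1ℤ))

  Σ-1 : ∀ (xs : List A) → Σ xs (λ _ → 1ℤ) ≡ + length xs
  Σ-1 xs = trans (Σ-const xs 1ℤ) (ZP.*-identityʳ _)

  Σ-++ : ∀ (xs ys : List A) (f : A → ℤ) → Σ (xs ++ ys) f ≡ Σ xs f + Σ ys f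
  Σ-++ []       ys f = sym (ZP.+-identityˡ _)
  Σ-++ (x ∷ xs) ys f = trans (cong (_+_ (f x)) (Σ-++ xs ys f)) (sym (ZP.+-assoc (f x) (Σ xs f) (Σ ys f)))

  Σ-filter : ∀ {P : A → Set} (P? : ∀ x → Dec (P x)) (xs : List A) (f : A → ℤ) →
             Σ (filter P? xs) f ≡ Σ xs (λ x → χ (P? x) * f x)
  Σ-filter P? []       f = refl
  Σ-filter P? (x ∷ xs) f with P? x
  ... | yes _ = cong₂ _+_ (sym (ZP.*-identityˡ (f x))) (Σ-filter P? xs f)
  ... | no _  = trans (Σ-filter P? xs f) (sym (ZP.+-identityˡ _))

  length-filter : ∀ {P : A → Set} (P? : ∀ x → Dec (P x)) (xs : List A) →
                  + length (filter P? xs) ≡ Σ xs (λ x → χ (P? x))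
  length-filter P? xs = begin
    + length (filter P? xs)          ≡⟨ Σ-1 (filter P? xs) ⟨
    Σ (filter P? xs) (λ _ → 1ℤ)      ≡⟨ Σ-filter P? xs (λ _ → 1ℤ) ⟩
    Σ xs (λ x → χ (P? x) * 1ℤ)       ≡⟨ Σ-cong xs (λ x → ZP.*-identityʳ _) ⟩
    Σ xs (λ x → χ (P? x))            ∎
    where open ≡-Reasoning

  Σ-filter-≤ : ∀ {P : A → Set} (P? : ∀ x → Dec (P x)) (xs : List A) (f : A → ℤ) →
               (∀ x → 0ℤ ≤ f x) → Σ (filter P? xs) f ≤ Σ xs f
  Σ-filter-≤ P? []       f 0≤f = ZP.≤-refl
  Σ-filter-≤ P? (x ∷ xs) f 0≤f with P? x
  ... | yes _ = ZP.+-mono-≤ (ZP.≤-refl {f x}) (Σ-filter-≤ P? xs f 0≤f)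
  ... | no _  = ≤-+-nonnegˡ (0≤f x) (Σ-filter-≤ P? xs f 0≤f)

module _ {A B : Set} where

  Σ-map : ∀ (g : A → B) (xs : List A) (f : B → ℤ) → Σ (map g xs) f ≡ Σ xs (f ∘ g)
  Σ-map g []       f = refl
  Σ-map g (x ∷ xs) f = cong (_+_ (f (g x))) (Σ-map g xs f)

  Σ-concatMap : ∀ (g : A → List B) (xs : List A) (f : B → ℤ) →
                Σ (concatMap g xs) f ≡ Σ xs (λ x → Σ (g x) f)
  Σ-concatMap g []       f = refl
  Σ-concatMap g (x ∷ xs) f =
    trans (Σ-++ (g x) (concatMap g xs) f) (cong (_+_ (Σ (g x) f)) (Σ-concatMap g xs f))

  Σ-swap : ∀ (xs : List A) (ys : List B) (f : A → B → ℤ) →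
           Σ xs (λ x → Σ ys (λ y → f x y)) ≡ Σ ys (λ y → Σ xs (λ x → f x y))
  Σ-swap []       ys f = sym (Σ-zero ys)
  Σ-swap (x ∷ xs) ys f =
    trans (cong (_+_ (Σ ys (f x))) (Σ-swap xs ys f)) (sym (Σ-+ ys (f x) (λ y → Σ xs (λ x' → f x' y))))

  Σ-*-Σ : ∀ (xs : List A) (ys : List B) (f : A → ℤ) (g : B → ℤ) →
          Σ xs f * Σ ys g ≡ Σ xs (λ x → Σ ys (λ y → f x * g y))
  Σ-*-Σ xs ys f g = trans (sym (Σ-*ʳ xs (Σ ys g) f)) (Σ-cong xs (λ x → sym (Σ-*ˡ ys (f x) g)))

pairs : ∀ {A B : Set} → List A → List B → List (A × B)
pairs xs ys = concatMap (λ a → map (a ,_) ys) xs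

Σ-pairs : ∀ {A B : Set} (xs : List A) (ys : List B) (f : A × B → ℤ) →
          Σ (pairs xs ys) f ≡ Σ xs (λ a → Σ ys (λ b → f (a , b)))
Σ-pairs xs ys f = trans (Σ-concatMap (λ a → map (a ,_) ys) xs f)
                        (Σ-cong xs (λ a → Σ-map (a ,_) ys f))

+sum≡Σ : ∀ {A : Set} (f : A → ℕ) (xs : List A) → + sum (map f xs) ≡ Σ xs (λ x → + f x)
+sum≡Σ f []       = refl
+sum≡Σ f (x ∷ xs) = trans (ZP.pos-+ (f x) _) (cong (_+_ (+ f x)) (+sum≡Σ f xs))

-- Summing (f s - f t)² over all pairs gives 2 (m Σ f² - (Σ f)²) ≥ 0.
Σ²≤length*Σsq : ∀ {A : Set} (xs : List A) (f : A → ℤ) →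
                Σ xs f * Σ xs f ≤ + length xs * Σ xs (λ t → f t * f t)
Σ²≤length*Σsq xs f =
  *-cancelˡ-≤-1≤ {+ 2} (+≤+ (ℕ.s≤s ℕ.z≤n))
    (ZP.0≤i-j⇒j≤i (subst₂ _≤_ refl Σsq-diff (0≤Σ xs (λ s → 0≤Σ xs (λ t → 0≤-sq (f s - f t))))))
  where
  m = + length xs
  S = Σ xs f
  Q = Σ xs (λ t → f t * f t)
  open ≡-Reasoning
  inner : ∀ s → Σ xs (λ t → (f s - f t) * (f s - f t)) ≡ m * (f s * f s) + (Q - (+ 2 * f s) * S)
  inner s = begin
    Σ xs (λ t → (f s - f t) * (f s - f t))
      ≡⟨ Σ-cong xs (λ t → expand (f s) (f t)) ⟩
    Σ xs (λ t → f s * f s + (f t * f t - (+ 2 * f s) * f t))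
      ≡⟨ Σ-+ xs (λ _ → f s * f s) (λ t → f t * f t - (+ 2 * f s) * f t) ⟩
    Σ xs (λ _ → f s * f s) + Σ xs (λ t → f t * f t - (+ 2 * f s) * f t)
      ≡⟨ cong₂ _+_ (Σ-const xs (f s * f s)) (Σ-- xs (λ t → f t * f t) (λ t → (+ 2 * f s) * f t)) ⟩
    m * (f s * f s) + (Q - Σ xs (λ t → (+ 2 * f s) * f t))
      ≡⟨ cong (λ u → m * (f s * f s) + (Q - u)) (Σ-*ˡ xs (+ 2 * f s) f) ⟩
    m * (f s * f s) + (Q - (+ 2 * f s) * S) ∎
    where
    expand : ∀ a b → (a - b) * (a - b) ≡ a * a + (b * b - (+ 2 * a) * b)
    expand = solve-∀
  Σsq-diff : Σ xs (λ s → Σ xs (λ t → (f s - f t) * (f s - f t))) ≡ + 2 * (m * Q) - + 2 * (S * S)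
  Σsq-diff = begin
    Σ xs (λ s → Σ xs (λ t → (f s - f t) * (f s - f t)))
      ≡⟨ Σ-cong xs inner ⟩
    Σ xs (λ s → m * (f s * f s) + (Q - (+ 2 * f s) * S))
      ≡⟨ Σ-+ xs (λ s → m * (f s * f s)) (λ s → Q - (+ 2 * f s) * S) ⟩
    Σ xs (λ s → m * (f s * f s)) + Σ xs (λ s → Q - (+ 2 * f s) * S)
      ≡⟨ cong₂ _+_ (Σ-*ˡ xs m (λ s → f s * f s)) (Σ-- xs (λ _ → Q) (λ s → (+ 2 * f s) * S)) ⟩
    m * Q + (Σ xs (λ _ → Q) - Σ xs (λ s → (+ 2 * f s) * S))
      ≡⟨ cong₂ (λ u v → m * Q + (u - v)) (Σ-const xs Q)
               (trans (Σ-*ʳ xs S (λ s → + 2 * f s)) (cong (_* S) (Σ-*ˡ xs (+ 2) f))) ⟩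
    m * Q + (m * Q - (+ 2 * S) * S)
      ≡⟨ collect m Q S ⟩
    + 2 * (m * Q) - + 2 * (S * S) ∎
    where
    collect : ∀ m Q S → m * Q + (m * Q - (+ 2 * S) * S) ≡ + 2 * (m * Q) - + 2 * (S * S)
    collect = solve-∀

Σ-swap-pairs : ∀ {A B C D : Set} (as : List A) (bs : List B) (cs : List C) (ds : List D)
               (f : A → B → C → D → ℤ) →
  Σ as (λ a → Σ bs (λ b → Σ cs (λ c → Σ ds (λ e → f a b c e)))) ≡
  Σ cs (λ c → Σ ds (λ e → Σ as (λ a → Σ bs (λ b → f a b c e))))
Σ-swap-pairs as bs cs ds f =
  trans (Σ-cong as (λ a → Σ-swap bs cs (λ b c → Σ ds (λ e → f a b c e))))
  (trans (Σ-swap as cs (λ a c → Σ bs (λ b → Σ ds (λ e → f a b c e))))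
  (Σ-cong cs (λ c → trans (Σ-cong as (λ a → Σ-swap bs ds (λ b e → f a b c e)))
                          (Σ-swap as ds (λ a e → Σ bs (λ b → f a b c e))))))

module Multiplicity (S : DecSetoid 0ℓ 0ℓ) where
  open DecSetoid S using (Carrier; _≈_; _≟_) renaming (refl to ≈-refl)

  Distinct : List Carrier → Set
  Distinct xs = ∀ v → Σ xs (λ y → χ (y ≟ v)) ≤ 1ℤ

  Distinct-tail : ∀ {x xs} → Distinct (x ∷ xs) → Distinct xs
  Distinct-tail {x} u v = ≤-drop-nonnegˡ (0≤χ (x ≟ v)) (u v)

  Distinct-head : ∀ {x xs} → Distinct (x ∷ xs) → Σ xs (λ y → χ (y ≟ x)) ≤ 0ℤ
  Distinct-head {x} {xs} u =
    subst₂ _≤_ (cancel (Σ xs (λ y → χ (y ≟ x)))) refl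
      (ZP.+-mono-≤ (ZP.≤-refl { - 1ℤ})
        (subst₂ _≤_ (cong (_+ Σ xs (λ y → χ (y ≟ x))) (χ-yes (x ≟ x) ≈-refl)) refl (u x)))
    where
    cancel : ∀ s → - 1ℤ + (1ℤ + s) ≡ s
    cancel = solve-∀

  Distinct-filter : ∀ {P : Carrier → Set} (P? : ∀ x → Dec (P x)) (xs : List Carrier) →
                    Distinct xs → Distinct (filter P? xs)
  Distinct-filter P? xs u v = ZP.≤-trans (Σ-filter-≤ P? xs (λ y → χ (y ≟ v)) (λ y → 0≤χ (y ≟ v))) (u v)

  count≤1 : ∀ {P : Carrier → Set} (P? : ∀ x → Dec (P x)) (xs : List Carrier) → Distinct xs →
            (∀ y y' → P y → P y' → y ≈ y') → Σ xs (λ y → χ (P? y)) ≤ 1ℤ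
  count≤1 P? []       u h = 0≤+ 1
  count≤1 P? (x ∷ xs) u h with P? x
  ... | yes px = subst₂ _≤_ refl (ZP.+-identityʳ 1ℤ) (ZP.+-mono-≤ (ZP.≤-refl {1ℤ})
                   (ZP.≤-trans (Σ-mono xs (λ y → χ-mono (P? y) (y ≟ x) (λ py → h y x py px)))
                               (Distinct-head {x} {xs} u)))
  ... | no _   = subst₂ _≤_ (sym (ZP.+-identityˡ _)) refl (count≤1 P? xs (Distinct-tail {x} {xs} u) h)

  count≤2 : ∀ {P : Carrier → Set} (P? : ∀ x → Dec (P x)) (g : Carrier → Carrier) (xs : List Carrier) →
            Distinct xs → (∀ y y' → P y → P y' → y ≈ y' ⊎ y ≈ g y') → Σ xs (λ y → χ (P? y)) ≤ + 2
  count≤2 P? g []       u h = 0≤+ 2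
  count≤2 P? g (x ∷ xs) u h with P? x
  ... | yes px = ZP.+-mono-≤ (ZP.≤-refl {1ℤ})
                   (ZP.≤-trans (Σ-mono xs bound)
                     (subst₂ _≤_ (sym (Σ-+ xs (λ y → χ (y ≟ x)) (λ y → χ (y ≟ g x)))) refl
                       (ZP.+-mono-≤ (Distinct-head {x} {xs} u) (Distinct-tail {x} {xs} u (g x)))))
    where
    bound : ∀ y → χ (P? y) ≤ χ (y ≟ x) + χ (y ≟ g x)
    bound y with P? y
    ... | no _ = ZP.+-mono-≤ (0≤χ (y ≟ x)) (0≤χ (y ≟ g x))
    ... | yes py with h y x py px
    ... | inj₁ y≈x  = subst₂ _≤_ refl (cong (_+ χ (y ≟ g x)) (sym (χ-yes (y ≟ x) y≈x)))
                        (≤-+-nonnegʳ (0≤χ (y ≟ g x)) ZP.≤-refl)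
    ... | inj₂ y≈gx = subst₂ _≤_ refl (cong (_+_ (χ (y ≟ x))) (sym (χ-yes (y ≟ g x) y≈gx)))
                        (≤-+-nonnegˡ (0≤χ (y ≟ x)) ZP.≤-refl)
  ... | no _   = subst₂ _≤_ (sym (ZP.+-identityˡ _)) refl (count≤2 P? g xs (Distinct-tail {x} {xs} u) h)

module Enumeration (S : DecSetoid 0ℓ 0ℓ) (U : List (DecSetoid.Carrier S))
                   (count-≈ : ∀ v → Σ U (λ u → χ (DecSetoid._≟_ S u v)) ≡ 1ℤ) where
  open DecSetoid S using (Carrier; _≈_; _≟_) renaming (sym to ≈-sym; trans to ≈-trans)
  open Multiplicity S using (Distinct)
  open ≡-Reasoning

  U-distinct : Distinct U
  U-distinct v = ZP.≤-reflexive (count-≈ v)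

  χ-sym : ∀ a b → χ (a ≟ b) ≡ χ (b ≟ a)
  χ-sym a b = χ-⇔ (a ≟ b) (b ≟ a) ≈-sym ≈-sym

  Σ-δ : ∀ (g : Carrier → ℤ) → (∀ {v w} → v ≈ w → g v ≡ g w) → ∀ v →
        Σ U (λ u → χ (v ≟ u) * g u) ≡ g v
  Σ-δ g g-resp v = begin
    Σ U (λ u → χ (v ≟ u) * g u)  ≡⟨ Σ-cong U pointwise ⟩
    Σ U (λ u → χ (u ≟ v) * g v)  ≡⟨ Σ-*ʳ U (g v) (λ u → χ (u ≟ v)) ⟩
    Σ U (λ u → χ (u ≟ v)) * g v  ≡⟨ cong (_* g v) (count-≈ v) ⟩
    1ℤ * g v                     ≡⟨ ZP.*-identityˡ (g v) ⟩
    g v                          ∎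
    where
    pointwise : ∀ u → χ (v ≟ u) * g u ≡ χ (u ≟ v) * g v
    pointwise u with v ≟ u | u ≟ v
    ... | yes v≈u | yes _   = cong (1ℤ *_) (g-resp (≈-sym v≈u))
    ... | yes v≈u | no u≉v  = ⊥-elim (u≉v (≈-sym v≈u))
    ... | no v≉u  | yes u≈v = ⊥-elim (v≉u (≈-sym u≈v))
    ... | no _    | no _    = refl

  Σ-χ-χ : ∀ a b → Σ U (λ u → χ (a ≟ u) * χ (b ≟ u)) ≡ χ (a ≟ b)
  Σ-χ-χ a b = trans (Σ-δ (λ u → χ (b ≟ u)) (λ {v} {w} v≈w → χ-⇔ (b ≟ v) (b ≟ w)
                      (λ b≈v → ≈-trans b≈v v≈w) (λ b≈w → ≈-trans b≈w (≈-sym v≈w))) a)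
                    (χ-sym b a)

  Σ-collisions : ∀ {A : Set} (L : List A) (f : A → Carrier) →
    Σ U (λ u → Σ L (λ x → χ (f x ≟ u)) * Σ L (λ x → χ (f x ≟ u)))
      ≡ Σ L (λ x → Σ L (λ x' → χ (f x ≟ f x')))
  Σ-collisions L f = begin
    Σ U (λ u → Σ L (λ x → χ (f x ≟ u)) * Σ L (λ x → χ (f x ≟ u)))
      ≡⟨ Σ-cong U (λ u → Σ-*-Σ L L (λ x → χ (f x ≟ u)) (λ x' → χ (f x' ≟ u))) ⟩
    Σ U (λ u → Σ L (λ x → Σ L (λ x' → χ (f x ≟ u) * χ (f x' ≟ u))))
      ≡⟨ Σ-swap U L _ ⟩
    Σ L (λ x → Σ U (λ u → Σ L (λ x' → χ (f x ≟ u) * χ (f x' ≟ u))))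
      ≡⟨ Σ-cong L (λ x → Σ-swap U L _) ⟩
    Σ L (λ x → Σ L (λ x' → Σ U (λ u → χ (f x ≟ u) * χ (f x' ≟ u))))
      ≡⟨ Σ-cong L (λ x → Σ-cong L (λ x' → Σ-χ-χ (f x) (f x'))) ⟩
    Σ L (λ x → Σ L (λ x' → χ (f x ≟ f x'))) ∎

  Σ-fibres : ∀ {I : Set} (g : Carrier → ℤ) → (∀ {v w} → v ≈ w → g v ≡ g w) →
             (is : List I) (h : I → ℤ) (f : I → Carrier) →
             Σ is (λ i → h i * g (f i)) ≡ Σ U (λ w → g w * Σ is (λ i → h i * χ (f i ≟ w)))
  Σ-fibres g g-resp is h f = begin
    Σ is (λ i → h i * g (f i))
      ≡⟨ Σ-cong is (λ i → cong (h i *_) (sym (Σ-δ g g-resp (f i)))) ⟩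
    Σ is (λ i → h i * Σ U (λ w → χ (f i ≟ w) * g w))
      ≡⟨ Σ-cong is (λ i → trans (sym (Σ-*ˡ U (h i) _)) (Σ-cong U (λ w → reorder (h i) (χ (f i ≟ w)) (g w)))) ⟩
    Σ is (λ i → Σ U (λ w → g w * (h i * χ (f i ≟ w))))
      ≡⟨ Σ-swap is U _ ⟩
    Σ U (λ w → Σ is (λ i → g w * (h i * χ (f i ≟ w))))
      ≡⟨ Σ-cong U (λ w → Σ-*ˡ is (g w) _) ⟩
    Σ U (λ w → g w * Σ is (λ i → h i * χ (f i ≟ w))) ∎
    where
    reorder : ∀ a b c → a * (b * c) ≡ c * (a * b)
    reorder = solve-∀

  Σ-fibres-≤ : ∀ {I : Set} (g : Carrier → ℤ) → (∀ {v w} → v ≈ w → g v ≡ g w) → (∀ w → 0ℤ ≤ g w) →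
               (is : List I) (h : I → ℤ) (f : I → Carrier) (M : ℤ) →
               (∀ w → Σ is (λ i → h i * χ (f i ≟ w)) ≤ M) →
               Σ is (λ i → h i * g (f i)) ≤ M * Σ U g
  Σ-fibres-≤ g g-resp 0≤g is h f M fibre≤M =
    subst₂ _≤_ (sym (Σ-fibres g g-resp is h f)) (Σ-*ˡ U M g)
      (Σ-mono U (λ w → subst₂ _≤_ refl (ZP.*-comm (g w) M) (*-monoˡ-≤-0≤ (0≤g w) (fibre≤M w))))

Σ-allFuns : ∀ {X : Set} (xs : List X) n (f : (Fin (suc n) → X) → ℤ) →
            Σ (allFuns xs (suc n)) f ≡ Σ xs (λ a → Σ (allFuns xs n) (λ v → f (a VF.∷ v)))
Σ-allFuns xs n f = trans (Σ-concatMap (λ a → map (a VF.∷_) (allFuns xs n)) xs f)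
                         (Σ-cong xs (λ a → Σ-map (a VF.∷_) (allFuns xs n) f))

Σ-allFuns-all : ∀ {X : Set} (xs : List X) {P : X → Set} (P? : ∀ y → Dec (P y)) k →
  Σ (allFuns xs k) (λ ys → χ (all? (λ j → P? (ys j)))) ≡ Σ xs (λ y → χ (P? y)) ^ k
Σ-allFuns-all xs P? zero = refl
Σ-allFuns-all xs P? (suc k) = begin
  Σ (allFuns xs (suc k)) (λ ys → χ (all? (λ j → P? (ys j))))
    ≡⟨ Σ-allFuns xs k _ ⟩
  Σ xs (λ a → Σ (allFuns xs k) (λ v → χ (all? (λ j → P? ((a VF.∷ v) j)))))
    ≡⟨ Σ-cong xs (λ a → Σ-cong (allFuns xs k) (λ v →
         trans (χ-⇔ (all? (λ j → P? ((a VF.∷ v) j))) (P? a ×-dec all? (λ j → P? (v j)))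
                  (λ h → h fz , h ∘ fs) (λ { (p , h) fz → p ; (p , h) (fs j) → h j }))
               (sym (χ-× (P? a) (all? (λ j → P? (v j))))))) ⟩
  Σ xs (λ a → Σ (allFuns xs k) (λ v → χ (P? a) * χ (all? (λ j → P? (v j)))))
    ≡⟨ Σ-cong xs (λ a → trans (Σ-*ˡ (allFuns xs k) (χ (P? a)) _) (cong (χ (P? a) *_) (Σ-allFuns-all xs P? k))) ⟩
  Σ xs (λ a → χ (P? a) * Σ xs (λ y → χ (P? y)) ^ k)
    ≡⟨ Σ-*ʳ xs _ (λ a → χ (P? a)) ⟩
  Σ xs (λ y → χ (P? y)) * Σ xs (λ y → χ (P? y)) ^ k ∎
  where open ≡-Reasoning

Σ-tabulate-zero : ∀ {X : Set} n (g : Fin n → X) (f : X → ℤ) → (∀ i → f (g i) ≡ 0ℤ) → Σ (tabulate g) f ≡ 0ℤ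
Σ-tabulate-zero zero    g f e = refl
Σ-tabulate-zero (suc n) g f e = cong₂ _+_ (e fz) (Σ-tabulate-zero n (g ∘ fs) f (e ∘ fs))

Σ-tabulate-δ : ∀ {X : Set} n (g : Fin n → X) (f : X → ℤ) (j : Fin n) →
               (∀ i → f (g i) ≡ χ (i FinP.≟ j)) → Σ (tabulate g) f ≡ 1ℤ
Σ-tabulate-δ (suc n) g f fz e =
  cong₂ _+_ (e fz) (Σ-tabulate-zero n (g ∘ fs) f (λ i → trans (e (fs i)) (χ-no (fs i FinP.≟ fz) λ ())))
Σ-tabulate-δ (suc n) g f (fs j) e =
  trans (cong₂ _+_ (trans (e fz) (χ-no (fz FinP.≟ fs j) λ ()))
                   (Σ-tabulate-δ n (g ∘ fs) f j (λ i → trans (e (fs i))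
                      (χ-⇔ (fs i FinP.≟ fs j) (i FinP.≟ j) FinP.suc-injective (cong fs)))))
        (ZP.+-identityˡ _)

-- Integer coefficients, interpreted as n × 1#, so that constant arithmetic normalises.
module IntegerCoefficientSolver {A : Set} {add mul : A → A → A} {neg : A → A} {zero₀ one : A}
         (isCommutativeRing : IsCommutativeRing _≡_ add mul neg zero₀ one) where

  private
    R : CommutativeRing 0ℓ 0ℓ
    R = record { isCommutativeRing = isCommutativeRing }

  open CommutativeRing R using (ring; +-abelianGroup; semiring; 0#; 1#)
    renaming (_+_ to _⊕_; _*_ to _⊗_; -_ to ⊖_;
              +-assoc to ⊕-assoc; +-comm to ⊕-comm; +-identityˡ to ⊕-identityˡ;
              +-identityʳ to ⊕-identityʳ; -‿inverseʳ to ⊖-inverseʳ)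
  open import Algebra.Properties.Ring ring using (-‿distribˡ-*; -‿distribʳ-*; -‿involutive; -0#≈0#)
  open import Algebra.Properties.AbelianGroup +-abelianGroup using (⁻¹-∙-comm)
  open SemiringMult semiring using (×-homo-+; ×1-homo-*) renaming (_×_ to _×ₙ_)
  open ≡-Reasoning

  ⟦_⟧ᶻ : ℤ → A
  ⟦ + n ⟧ᶻ      = n ×ₙ 1#
  ⟦ -[1+ n ] ⟧ᶻ = ⊖ (suc n ×ₙ 1#)

  private
    infixl 6 _⊝_
    _⊝_ : A → A → A
    a ⊝ b = a ⊕ ⊖ b

    [a+c]-[b+c]≡a-b : ∀ a b c → (a ⊕ c) ⊝ (b ⊕ c) ≡ a ⊝ b
    [a+c]-[b+c]≡a-b a b c = begin
      (a ⊕ c) ⊕ ⊖ (b ⊕ c)        ≡⟨ cong ((a ⊕ c) ⊕_) (sym (⁻¹-∙-comm b c)) ⟩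
      (a ⊕ c) ⊕ (⊖ b ⊕ ⊖ c)      ≡⟨ ⊕-assoc a c (⊖ b ⊕ ⊖ c) ⟩
      a ⊕ (c ⊕ (⊖ b ⊕ ⊖ c))      ≡⟨ cong (λ t → a ⊕ (c ⊕ t)) (⊕-comm (⊖ b) (⊖ c)) ⟩
      a ⊕ (c ⊕ (⊖ c ⊕ ⊖ b))      ≡⟨ cong (a ⊕_) (sym (⊕-assoc c (⊖ c) (⊖ b))) ⟩
      a ⊕ ((c ⊕ ⊖ c) ⊕ ⊖ b)      ≡⟨ cong (λ t → a ⊕ (t ⊕ ⊖ b)) (⊖-inverseʳ c) ⟩
      a ⊕ (0# ⊕ ⊖ b)             ≡⟨ cong (a ⊕_) (⊕-identityˡ (⊖ b)) ⟩
      a ⊕ ⊖ b                    ∎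

    ⟦⊖⟧ : ∀ m n → ⟦ m ℤ.⊖ n ⟧ᶻ ≡ (m ×ₙ 1#) ⊝ (n ×ₙ 1#)
    ⟦⊖⟧ m zero = begin
      ⟦ m ℤ.⊖ 0 ⟧ᶻ         ≡⟨ cong ⟦_⟧ᶻ (ZP.⊖-≥ {m} {0} ℕ.z≤n) ⟩
      m ×ₙ 1#              ≡⟨ ⊕-identityʳ _ ⟨
      m ×ₙ 1# ⊕ 0#         ≡⟨ cong (m ×ₙ 1# ⊕_) -0#≈0# ⟨
      m ×ₙ 1# ⊕ ⊖ 0#       ∎
    ⟦⊖⟧ zero (suc n) = begin
      ⟦ 0 ℤ.⊖ suc n ⟧ᶻ     ≡⟨ cong ⟦_⟧ᶻ (ZP.⊖-< {0} {suc n} (ℕ.s≤s ℕ.z≤n)) ⟩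
      ⊖ (suc n ×ₙ 1#)      ≡⟨ ⊕-identityˡ _ ⟨
      0# ⊕ ⊖ (suc n ×ₙ 1#) ∎
    ⟦⊖⟧ (suc m) (suc n) = begin
      ⟦ suc m ℤ.⊖ suc n ⟧ᶻ              ≡⟨ cong ⟦_⟧ᶻ (ZP.[1+m]⊖[1+n]≡m⊖n m n) ⟩
      ⟦ m ℤ.⊖ n ⟧ᶻ                      ≡⟨ ⟦⊖⟧ m n ⟩
      (m ×ₙ 1#) ⊝ (n ×ₙ 1#)             ≡⟨ [a+c]-[b+c]≡a-b (m ×ₙ 1#) (n ×ₙ 1#) 1# ⟨
      (m ×ₙ 1# ⊕ 1#) ⊝ (n ×ₙ 1# ⊕ 1#)   ≡⟨ cong₂ _⊝_ (⊕-comm _ 1#) (⊕-comm _ 1#) ⟩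
      (1# ⊕ m ×ₙ 1#) ⊝ (1# ⊕ n ×ₙ 1#)   ∎

    signed : Sign.Sign → A → A
    signed Sign.+ x = x
    signed Sign.- x = ⊖ x

    ⟦◃⟧ : ∀ s k → ⟦ s ℤ.◃ k ⟧ᶻ ≡ signed s (k ×ₙ 1#)
    ⟦◃⟧ Sign.+ zero    = refl
    ⟦◃⟧ Sign.- zero    = sym -0#≈0#
    ⟦◃⟧ Sign.+ (suc k) = refl
    ⟦◃⟧ Sign.- (suc k) = refl

    ⟦⟧-signed : ∀ i → ⟦ i ⟧ᶻ ≡ signed (ℤ.sign i) (∣ i ∣ ×ₙ 1#)
    ⟦⟧-signed (+ n)    = refl
    ⟦⟧-signed -[1+ n ] = refl

    signed-* : ∀ s t a b → signed (s Sign.* t) (a ⊗ b) ≡ signed s a ⊗ signed t b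
    signed-* Sign.+ Sign.+ a b = refl
    signed-* Sign.+ Sign.- a b = -‿distribʳ-* a b
    signed-* Sign.- Sign.+ a b = -‿distribˡ-* a b
    signed-* Sign.- Sign.- a b = begin
      a ⊗ b           ≡⟨ -‿involutive _ ⟨
      ⊖ ⊖ (a ⊗ b)     ≡⟨ cong ⊖_ (-‿distribˡ-* a b) ⟩
      ⊖ (⊖ a ⊗ b)     ≡⟨ -‿distribʳ-* (⊖ a) b ⟩
      ⊖ a ⊗ ⊖ b       ∎

    ⟦⟧-*-homo : ∀ i j → ⟦ i * j ⟧ᶻ ≡ ⟦ i ⟧ᶻ ⊗ ⟦ j ⟧ᶻ
    ⟦⟧-*-homo i j = begin
      ⟦ i * j ⟧ᶻ
        ≡⟨ ⟦◃⟧ (ℤ.sign i Sign.* ℤ.sign j) (∣ i ∣ ℕ.* ∣ j ∣) ⟩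
      signed (ℤ.sign i Sign.* ℤ.sign j) ((∣ i ∣ ℕ.* ∣ j ∣) ×ₙ 1#)
        ≡⟨ cong (signed (ℤ.sign i Sign.* ℤ.sign j)) (×1-homo-* ∣ i ∣ ∣ j ∣) ⟩
      signed (ℤ.sign i Sign.* ℤ.sign j) ((∣ i ∣ ×ₙ 1#) ⊗ (∣ j ∣ ×ₙ 1#))
        ≡⟨ signed-* (ℤ.sign i) (ℤ.sign j) _ _ ⟩
      signed (ℤ.sign i) (∣ i ∣ ×ₙ 1#) ⊗ signed (ℤ.sign j) (∣ j ∣ ×ₙ 1#)
        ≡⟨ cong₂ _⊗_ (⟦⟧-signed i) (⟦⟧-signed j) ⟨
      ⟦ i ⟧ᶻ ⊗ ⟦ j ⟧ᶻ ∎

    ⟦⟧-+-homo : ∀ i j → ⟦ i + j ⟧ᶻ ≡ ⟦ i ⟧ᶻ ⊕ ⟦ j ⟧ᶻ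
    ⟦⟧-+-homo (+ m)    (+ n)    = ×-homo-+ 1# m n
    ⟦⟧-+-homo (+ m)    -[1+ n ] = ⟦⊖⟧ m (suc n)
    ⟦⟧-+-homo -[1+ m ] (+ n)    = trans (⟦⊖⟧ n (suc m)) (⊕-comm _ _)
    ⟦⟧-+-homo -[1+ m ] -[1+ n ] = begin
      ⊖ (suc (suc (m ℕ.+ n)) ×ₙ 1#)    ≡⟨ cong (λ t → ⊖ (t ×ₙ 1#)) (sym (ℕP.+-suc (suc m) n)) ⟩
      ⊖ ((suc m ℕ.+ suc n) ×ₙ 1#)      ≡⟨ cong ⊖_ (×-homo-+ 1# (suc m) (suc n)) ⟩
      ⊖ (suc m ×ₙ 1# ⊕ suc n ×ₙ 1#)    ≡⟨ ⁻¹-∙-comm _ _ ⟨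
      ⊖ (suc m ×ₙ 1#) ⊕ ⊖ (suc n ×ₙ 1#) ∎

    ⟦⟧-neg-homo : ∀ i → ⟦ - i ⟧ᶻ ≡ ⊖ ⟦ i ⟧ᶻ
    ⟦⟧-neg-homo (+ zero)  = sym -0#≈0#
    ⟦⟧-neg-homo (+ suc n) = refl
    ⟦⟧-neg-homo -[1+ n ]  = sym (-‿involutive _)

    homomorphism : ℤ.+-*-rawRing ACR.-Raw-AlmostCommutative⟶ ACR.fromCommutativeRing R
    homomorphism = record
      { ⟦_⟧ = ⟦_⟧ᶻ ; +-homo = ⟦⟧-+-homo ; *-homo = ⟦⟧-*-homo ; -‿homo = ⟦⟧-neg-homo
      ; 0-homo = refl ; 1-homo = ⊕-identityʳ 1# }

    coefficient≟ : ∀ i j → Maybe (⟦ i ⟧ᶻ ≡ ⟦ j ⟧ᶻ)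
    coefficient≟ i j with i ZP.≟ j
    ... | yes refl = just refl
    ... | no _     = nothing

  open import Algebra.Solver.Ring ℤ.+-*-rawRing (ACR.fromCommutativeRing R) homomorphism coefficient≟ public
    using (solve; _:=_; _:+_; _:*_; _:-_; :-_; con)

module _ (F : FiniteField) where
  open FiniteField F using (Carrier; 0#; 1#; isCommutativeRing; 0≢1; inverse; size; enum; elements)
    renaming (_+_ to _⊕_; _*_ to _⊗_; -_ to ⊖_; _-_ to _⊝_; _≟_ to infix 4 _≟_)
  private
    ring : CommutativeRing 0ℓ 0ℓ
    ring = record { isCommutativeRing = isCommutativeRing }
  open CommutativeRing ring
    using () renaming (+-identityˡ to ⊕-identityˡ; +-identityʳ to ⊕-identityʳ; +-comm to ⊕-comm;
                       *-identityˡ to ⊗-identityˡ; *-identityʳ to ⊗-identityʳ; *-comm to ⊗-comm;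
                       zeroʳ to ⊗-zeroʳ; distribʳ to ⊗-distribʳ)
  open IntegerCoefficientSolver isCommutativeRing

  x-y≡0⇒x≡y : ∀ {x y} → x ⊝ y ≡ 0# → x ≡ y
  x-y≡0⇒x≡y {x} {y} e = begin
    x               ≡⟨ solve 2 (λ x y → x := (x :- y) :+ y) refl x y ⟩
    (x ⊝ y) ⊕ y     ≡⟨ cong (_⊕ y) e ⟩
    0# ⊕ y          ≡⟨ ⊕-identityˡ y ⟩
    y               ∎
    where open ≡-Reasoning

  x≡y⇒x-y≡0 : ∀ {x y} → x ≡ y → x ⊝ y ≡ 0#
  x≡y⇒x-y≡0 {x} refl = solve 1 (λ x → x :- x := con 0ℤ) refl x

  x+y≡z⇒y≡z-x : ∀ {x y z} → x ⊕ y ≡ z → y ≡ z ⊝ x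
  x+y≡z⇒y≡z-x {x} {y} e = trans (solve 2 (λ x y → y := (x :+ y) :- x) refl x y) (cong (_⊝ x) e)

  y≡z-x⇒x+y≡z : ∀ {x y z} → y ≡ z ⊝ x → x ⊕ y ≡ z
  y≡z-x⇒x+y≡z {x} {y} {z} e = trans (cong (x ⊕_) e) (solve 2 (λ x z → x :+ (z :- x) := z) refl x z)

  ⊕-cancelʳ : ∀ {a b c} → b ⊕ a ≡ c ⊕ a → b ≡ c
  ⊕-cancelʳ {a} {b} {c} e = begin
    b              ≡⟨ solve 2 (λ a b → b := (b :+ a) :- a) refl a b ⟩
    (b ⊕ a) ⊝ a    ≡⟨ cong (_⊝ a) e ⟩
    (c ⊕ a) ⊝ a    ≡⟨ solve 2 (λ a c → (c :+ a) :- a := c) refl a c ⟩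
    c              ∎
    where open ≡-Reasoning

  ⊕-cancelˡ : ∀ {a b c} → a ⊕ b ≡ a ⊕ c → b ≡ c
  ⊕-cancelˡ {a} {b} {c} e = ⊕-cancelʳ (trans (⊕-comm b a) (trans e (⊕-comm a c)))

  -x≡0⇒x≡0 : ∀ {x} → ⊖ x ≡ 0# → x ≡ 0#
  -x≡0⇒x≡0 {x} e = trans (solve 1 (λ x → x := :- (:- x)) refl x)
                         (trans (cong ⊖_ e) (solve 0 (:- con 0ℤ := con 0ℤ) refl))

  x*y≡0⇒x≡0∨y≡0 : ∀ {x y} → x ⊗ y ≡ 0# → x ≡ 0# ⊎ y ≡ 0#
  x*y≡0⇒x≡0∨y≡0 {x} {y} e with x ≟ 0#
  ... | yes x≡0 = inj₁ x≡0
  ... | no x≢0  with inverse x x≢0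
  ... | (x⁻¹ , xx⁻¹≡1) = inj₂ (begin
    y                ≡⟨ ⊗-identityˡ y ⟨
    1# ⊗ y           ≡⟨ cong (_⊗ y) xx⁻¹≡1 ⟨
    (x ⊗ x⁻¹) ⊗ y    ≡⟨ solve 3 (λ x x⁻¹ y → (x :* x⁻¹) :* y := x⁻¹ :* (x :* y)) refl x x⁻¹ y ⟩
    x⁻¹ ⊗ (x ⊗ y)    ≡⟨ cong (x⁻¹ ⊗_) e ⟩
    x⁻¹ ⊗ 0#         ≡⟨ ⊗-zeroʳ x⁻¹ ⟩
    0#               ∎)
    where open ≡-Reasoning

  x≢0∧y≢0⇒x*y≢0 : ∀ {x y} → ¬ x ≡ 0# → ¬ y ≡ 0# → ¬ x ⊗ y ≡ 0#
  x≢0∧y≢0⇒x*y≢0 x≢0 y≢0 e with x*y≡0⇒x≡0∨y≡0 e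
  ... | inj₁ x≡0 = x≢0 x≡0
  ... | inj₂ y≡0 = y≢0 y≡0

  ⊗-cancelˡ : ∀ {c a b} → ¬ c ≡ 0# → c ⊗ a ≡ c ⊗ b → a ≡ b
  ⊗-cancelˡ {c} {a} {b} c≢0 e
    with x*y≡0⇒x≡0∨y≡0 {c} {a ⊝ b}
           (trans (solve 3 (λ c a b → c :* (a :- b) := c :* a :- c :* b) refl c a b) (x≡y⇒x-y≡0 e))
  ... | inj₁ c≡0   = ⊥-elim (c≢0 c≡0)
  ... | inj₂ a-b≡0 = x-y≡0⇒x≡y a-b≡0

  x*x≡y*y⇒x≡y∨x≡-y : ∀ {x y} → x ⊗ x ≡ y ⊗ y → x ≡ y ⊎ x ≡ ⊖ y
  x*x≡y*y⇒x≡y∨x≡-y {x} {y} e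
    with x*y≡0⇒x≡0∨y≡0 {x ⊝ y} {x ⊕ y}
           (trans (solve 2 (λ x y → (x :- y) :* (x :+ y) := x :* x :- y :* y) refl x y) (x≡y⇒x-y≡0 e))
  ... | inj₁ x-y≡0 = inj₁ (x-y≡0⇒x≡y x-y≡0)
  ... | inj₂ x+y≡0 = inj₂ (x-y≡0⇒x≡y (trans (solve 2 (λ x y → x :- (:- y) := x :+ y) refl x y) x+y≡0))

  x+x≡y+y⇒x≡y : OddChar F → ∀ {x y} → x ⊕ x ≡ y ⊕ y → x ≡ y
  x+x≡y+y⇒x≡y odd {x} {y} e = ⊗-cancelˡ {1# ⊕ 1#} odd (begin
    (1# ⊕ 1#) ⊗ x    ≡⟨ twice x ⟩
    x ⊕ x            ≡⟨ e ⟩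
    y ⊕ y            ≡⟨ twice y ⟨
    (1# ⊕ 1#) ⊗ y    ∎)
    where
    open ≡-Reasoning
    twice : ∀ z → (1# ⊕ 1#) ⊗ z ≡ z ⊕ z
    twice z = trans (⊗-distribʳ z 1# 1#) (cong₂ _⊕_ (⊗-identityˡ z) (⊗-identityˡ z))

  infix 8 _·_
  infixr 7 _*ᵥ_
  infixl 6 _+ᵥ_ _-ᵥ′_

  -- x · x unfolds to ‖ x ‖, x -ᵥ′ y to x -ᵥ y and _≈ᵥ?_ to all?, so the filter predicate in ν
  -- is definitionally a ≈ᵥ?-test on distance vectors; energy≡ΣN^k relies on this.
  _·_ : ∀ {d} → Pt F d → Pt F d → Carrier
  x · w = VF.foldr _⊕_ 0# (λ i → x i ⊗ w i)

  _*ᵥ_ : ∀ {d} → Carrier → Pt F d → Pt F d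
  (c *ᵥ x) i = c ⊗ x i

  _+ᵥ_ : ∀ {d} → Pt F d → Pt F d → Pt F d
  (x +ᵥ y) i = x i ⊕ y i

  _-ᵥ′_ : ∀ {d} → Pt F d → Pt F d → Pt F d
  _-ᵥ′_ = _-ᵥ_ F

  0ᵥ : ∀ {d} → Pt F d
  0ᵥ _ = 0#

  ≈ᵥ-decSetoid : ℕ → DecSetoid 0ℓ 0ℓ
  ≈ᵥ-decSetoid = PW.decSetoid (≡.decSetoid _≟_)

  module _ {d : ℕ} where
    open DecSetoid (≈ᵥ-decSetoid d) public using () renaming (_≈_ to _≈ᵥ_; _≟_ to _≈ᵥ?_; sym to ≈ᵥ-sym)

  ·-cong : ∀ {d} {x x′ w w′ : Pt F d} → x ≈ᵥ x′ → w ≈ᵥ w′ → x · w ≡ x′ · w′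
  ·-cong {zero}  ex ew = refl
  ·-cong {suc d} ex ew = cong₂ _⊕_ (cong₂ _⊗_ (ex fz) (ew fz)) (·-cong (ex ∘ fs) (ew ∘ fs))

  ·-zeroˡ : ∀ {d} (x w : Pt F d) → x ≈ᵥ 0ᵥ → x · w ≡ 0#
  ·-zeroˡ {zero}  x w e = refl
  ·-zeroˡ {suc d} x w e = begin
    x fz ⊗ w fz ⊕ (x ∘ fs) · (w ∘ fs)
      ≡⟨ cong₂ _⊕_ (cong (_⊗ w fz) (e fz)) (·-zeroˡ (x ∘ fs) (w ∘ fs) (e ∘ fs)) ⟩
    0# ⊗ w fz ⊕ 0#
      ≡⟨ solve 1 (λ w → con 0ℤ :* w :+ con 0ℤ := con 0ℤ) refl (w fz) ⟩
    0# ∎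
    where open ≡-Reasoning

  ·-distribʳ-- : ∀ {d} (x x′ w : Pt F d) → (x -ᵥ′ x′) · w ≡ x · w ⊝ x′ · w
  ·-distribʳ-- {zero}  x x′ w = solve 0 (con 0ℤ := con 0ℤ :- con 0ℤ) refl
  ·-distribʳ-- {suc d} x x′ w =
    trans (cong ((x fz ⊝ x′ fz) ⊗ w fz ⊕_) (·-distribʳ-- (x ∘ fs) (x′ ∘ fs) (w ∘ fs)))
      (solve 5 (λ a b c S T → (a :- b) :* c :+ (S :- T) := (a :* c :+ S) :- (b :* c :+ T)) refl
         (x fz) (x′ fz) (w fz) ((x ∘ fs) · (w ∘ fs)) ((x′ ∘ fs) · (w ∘ fs)))

  ·-*ᵥʳ : ∀ {d} (c : Carrier) (x w : Pt F d) → x · (c *ᵥ w) ≡ c ⊗ x · w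
  ·-*ᵥʳ {zero}  c x w = sym (⊗-zeroʳ c)
  ·-*ᵥʳ {suc d} c x w =
    trans (cong (x fz ⊗ (c ⊗ w fz) ⊕_) (·-*ᵥʳ c (x ∘ fs) (w ∘ fs)))
      (solve 4 (λ a c b S → a :* (c :* b) :+ c :* S := c :* (a :* b :+ S)) refl
         (x fz) c (w fz) ((x ∘ fs) · (w ∘ fs)))

  ·-distribˡ-+ᵥ : ∀ {d} (x w w′ : Pt F d) → x · (w +ᵥ w′) ≡ x · w ⊕ x · w′
  ·-distribˡ-+ᵥ {zero}  x w w′ = sym (⊕-identityˡ 0#)
  ·-distribˡ-+ᵥ {suc d} x w w′ =
    trans (cong (x fz ⊗ (w fz ⊕ w′ fz) ⊕_) (·-distribˡ-+ᵥ (x ∘ fs) (w ∘ fs) (w′ ∘ fs)))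
      (solve 5 (λ a b c S T → a :* (b :+ c) :+ (S :+ T) := (a :* b :+ S) :+ (a :* c :+ T)) refl
         (x fz) (w fz) (w′ fz) ((x ∘ fs) · (w ∘ fs)) ((x ∘ fs) · (w′ ∘ fs)))

  ‖*ᵥ‖ : ∀ {d} (c : Carrier) (y : Pt F d) → (c *ᵥ y) · (c *ᵥ y) ≡ (c ⊗ c) ⊗ y · y
  ‖*ᵥ‖ {zero}  c y = sym (⊗-zeroʳ _)
  ‖*ᵥ‖ {suc d} c y =
    trans (cong ((c ⊗ y fz) ⊗ (c ⊗ y fz) ⊕_) (‖*ᵥ‖ c (y ∘ fs)))
      (solve 3 (λ c a S → (c :* a) :* (c :* a) :+ (c :* c) :* S := (c :* c) :* (a :* a :+ S)) refl
         c (y fz) ((y ∘ fs) · (y ∘ fs)))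

  ‖-ᵥ‖ : ∀ {d} (x y : Pt F d) → (x -ᵥ′ y) · (x -ᵥ′ y) ⊕ (x · y ⊕ x · y) ≡ x · x ⊕ y · y
  ‖-ᵥ‖ {zero}  x y = solve 0 (con 0ℤ :+ (con 0ℤ :+ con 0ℤ) := con 0ℤ :+ con 0ℤ) refl
  ‖-ᵥ‖ {suc d} x y = begin
    ((a ⊝ b) ⊗ (a ⊝ b) ⊕ r) ⊕ ((a ⊗ b ⊕ r·) ⊕ (a ⊗ b ⊕ r·))
      ≡⟨ solve 4 (λ a b r r· → ((a :- b) :* (a :- b) :+ r) :+ ((a :* b :+ r·) :+ (a :* b :+ r·))
                         := (a :* a :+ b :* b) :+ (r :+ (r· :+ r·))) refl a b r r· ⟩
    (a ⊗ a ⊕ b ⊗ b) ⊕ (r ⊕ (r· ⊕ r·))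
      ≡⟨ cong ((a ⊗ a ⊕ b ⊗ b) ⊕_) (‖-ᵥ‖ (x ∘ fs) (y ∘ fs)) ⟩
    (a ⊗ a ⊕ b ⊗ b) ⊕ (rx ⊕ ry)
      ≡⟨ solve 4 (λ a b rx ry → (a :* a :+ b :* b) :+ (rx :+ ry) := (a :* a :+ rx) :+ (b :* b :+ ry))
                 refl a b rx ry ⟩
    (a ⊗ a ⊕ rx) ⊕ (b ⊗ b ⊕ ry) ∎
    where
    open ≡-Reasoning
    a = x fz
    b = y fz
    r = ((x ∘ fs) -ᵥ′ (y ∘ fs)) · ((x ∘ fs) -ᵥ′ (y ∘ fs))
    r· = (x ∘ fs) · (y ∘ fs)
    rx = (x ∘ fs) · (x ∘ fs)
    ry = (y ∘ fs) · (y ∘ fs)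

  -- Cancelling the 2 in 2 x·y = ‖x‖ + ‖y‖ - ‖x - y‖ needs odd characteristic.
  equidistant⇔same-dot : OddChar F → ∀ {d} (x x′ y : Pt F d) → x · x ≡ 1# → x′ · x′ ≡ 1# →
    ((x -ᵥ′ y) · (x -ᵥ′ y) ≡ (x′ -ᵥ′ y) · (x′ -ᵥ′ y) → x · y ≡ x′ · y) ×
    (x · y ≡ x′ · y → (x -ᵥ′ y) · (x -ᵥ′ y) ≡ (x′ -ᵥ′ y) · (x′ -ᵥ′ y))
  equidistant⇔same-dot odd x x′ y ‖x‖≡1 ‖x′‖≡1 =
      (λ e → x+x≡y+y⇒x≡y odd (⊕-cancelˡ (trans (‖-ᵥ‖ x y) (trans ‖x‖+‖y‖ (trans (sym (‖-ᵥ‖ x′ y))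
               (cong (_⊕ (x′ · y ⊕ x′ · y)) (sym e)))))))
    , (λ e → ⊕-cancelʳ (trans (‖-ᵥ‖ x y) (trans ‖x‖+‖y‖ (trans (sym (‖-ᵥ‖ x′ y))
               (cong (λ u → (x′ -ᵥ′ y) · (x′ -ᵥ′ y) ⊕ (u ⊕ u)) (sym e))))))
    where
    ‖x‖+‖y‖ : x · x ⊕ y · y ≡ x′ · x′ ⊕ y · y
    ‖x‖+‖y‖ = cong (_⊕ y · y) (trans ‖x‖≡1 (sym ‖x′‖≡1))

  q : ℤ
  q = + size

  Σ-elements-1 : Σ elements (λ _ → 1ℤ) ≡ q
  Σ-elements-1 = trans (Σ-1 elements)
    (cong +_ (trans (ListP.length-map (Inverse.to enum) (allFin size)) (ListP.length-tabulate {n = size} id)))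

  elements-count : ∀ a → Σ elements (λ t → χ (t ≟ a)) ≡ 1ℤ
  elements-count a = trans (Σ-map (Inverse.to enum) (allFin size) (λ t → χ (t ≟ a)))
    (Σ-tabulate-δ size id (λ i → χ (Inverse.to enum i ≟ a)) (Inverse.from enum a)
      (λ i → χ-⇔ (Inverse.to enum i ≟ a) (i FinP.≟ Inverse.from enum a)
        (λ e → trans (sym (Inverse.strictlyInverseʳ enum i)) (cong (Inverse.from enum) e))
        (λ e → trans (cong (Inverse.to enum) e) (Inverse.strictlyInverseˡ enum a))))

  module Elements = Enumeration (≡.decSetoid _≟_) elements elements-count

  space-count : ∀ d (v : Pt F d) → Σ (space F d) (λ w → χ (w ≈ᵥ? v)) ≡ 1ℤ
  space-count zero    v = cong (_+ 0ℤ) (χ-yes ((λ ()) ≈ᵥ? v) (λ ()))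
  space-count (suc d) v = begin
    Σ (space F (suc d)) (λ w → χ (w ≈ᵥ? v))
      ≡⟨ Σ-allFuns elements d (λ w → χ (w ≈ᵥ? v)) ⟩
    Σ elements (λ a → Σ (space F d) (λ w → χ ((a VF.∷ w) ≈ᵥ? v)))
      ≡⟨ Σ-cong elements (λ a → Σ-cong (space F d) (λ w →
           trans (χ-⇔ ((a VF.∷ w) ≈ᵥ? v) ((a ≟ v fz) ×-dec (w ≈ᵥ? (v ∘ fs)))
                      (λ e → e fz , e ∘ fs) (λ { (e , e′) fz → e ; (e , e′) (fs i) → e′ i }))
                 (sym (χ-× (a ≟ v fz) (w ≈ᵥ? (v ∘ fs)))))) ⟩
    Σ elements (λ a → Σ (space F d) (λ w → χ (a ≟ v fz) * χ (w ≈ᵥ? (v ∘ fs))))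
      ≡⟨ Σ-cong elements (λ a → trans (Σ-*ˡ (space F d) (χ (a ≟ v fz)) (λ w → χ (w ≈ᵥ? (v ∘ fs))))
           (trans (cong (χ (a ≟ v fz) *_) (space-count d (v ∘ fs))) (ZP.*-identityʳ _))) ⟩
    Σ elements (λ a → χ (a ≟ v fz))
      ≡⟨ elements-count (v fz) ⟩
    1ℤ ∎
    where open ≡-Reasoning

  module Space (d : ℕ) = Enumeration (≈ᵥ-decSetoid d) (space F d) (space-count d)

  Σ-space-1 : ∀ d → Σ (space F d) (λ _ → 1ℤ) ≡ q ^ d
  Σ-space-1 zero    = refl
  Σ-space-1 (suc d) = begin
    Σ (space F (suc d)) (λ _ → 1ℤ)              ≡⟨ Σ-allFuns elements d (λ _ → 1ℤ) ⟩
    Σ elements (λ a → Σ (space F d) (λ _ → 1ℤ)) ≡⟨ Σ-cong elements (λ a → Σ-space-1 d) ⟩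
    Σ elements (λ a → q ^ d)                    ≡⟨ Σ-cong elements (λ _ → ZP.*-identityˡ (q ^ d)) ⟨
    Σ elements (λ a → 1ℤ * q ^ d)               ≡⟨ Σ-*ʳ elements (q ^ d) (λ _ → 1ℤ) ⟩
    Σ elements (λ _ → 1ℤ) * q ^ d               ≡⟨ cong (_* q ^ d) Σ-elements-1 ⟩
    q * q ^ d                                   ∎
    where open ≡-Reasoning

  χ≢0 : Carrier → ℤ
  χ≢0 t = χ (¬? (t ≟ 0#))

  χ≢0-≡0 : ∀ {t} → t ≡ 0# → χ≢0 t ≡ 0ℤ
  χ≢0-≡0 {t} t≡0 = χ-no (¬? (t ≟ 0#)) (λ t≢0 → t≢0 t≡0)

  χ≢0-≢0 : ∀ {t} → ¬ t ≡ 0# → χ≢0 t ≡ 1ℤ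
  χ≢0-≢0 {t} = χ-yes (¬? (t ≟ 0#))

  Σ-χ≢0 : Σ elements χ≢0 ≡ q - 1ℤ
  Σ-χ≢0 = trans (Σ-cong elements (λ t → χ-¬ (t ≟ 0#)))
    (trans (Σ-- elements (λ _ → 1ℤ) (λ t → χ (t ≟ 0#))) (cong₂ _-_ Σ-elements-1 (elements-count 0#)))

  Σ-χ≢0-* : ∀ (f : Carrier → ℤ) (X : ℤ) → (∀ t → ¬ t ≡ 0# → f t ≡ X) →
            Σ elements (λ t → χ≢0 t * f t) ≡ (q - 1ℤ) * X
  Σ-χ≢0-* f X f≡X = trans (Σ-cong elements pointwise) (trans (Σ-*ʳ elements X χ≢0) (cong (_* X) Σ-χ≢0))
    where
    pointwise : ∀ t → χ≢0 t * f t ≡ χ≢0 t * X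
    pointwise t with t ≟ 0#
    ... | yes _  = refl
    ... | no t≢0 = cong (1ℤ *_) (f≡X t t≢0)

  1≤q-1 : 1ℤ ≤ q - 1ℤ
  1≤q-1 = subst₂ _≤_ (elements-count 1#) Σ-χ≢0
    (Σ-mono elements (λ t → χ-mono (t ≟ 1#) (¬? (t ≟ 0#)) (λ t≡1 t≡0 → 0≢1 (trans (sym t≡0) t≡1))))

  0≤q-1 : 0ℤ ≤ q - 1ℤ
  0≤q-1 = ZP.≤-trans (0≤+ 1) 1≤q-1

  q-1≤q : q - 1ℤ ≤ q
  q-1≤q = ZP.i-j≤i q 1ℤ

  1≤q : 1ℤ ≤ q
  1≤q = ZP.≤-trans 1≤q-1 q-1≤q

  count-square-roots≤2 : ∀ a → Σ elements (λ t → χ ((t ⊗ t) ≟ a)) ≤ + 2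
  count-square-roots≤2 a = Multiplicity.count≤2 (≡.decSetoid _≟_) (λ t → (t ⊗ t) ≟ a) ⊖_ elements
    Elements.U-distinct (λ y y′ y²≡a y′²≡a → x*x≡y*y⇒x≡y∨x≡-y (trans y²≡a (sym y′²≡a)))

  count-linear : ∀ {b} → ¬ b ≡ 0# → ∀ t → Σ elements (λ a → χ ((b ⊗ a) ≟ t)) ≡ 1ℤ
  count-linear {b} b≢0 t with inverse b b≢0
  ... | (b⁻¹ , bb⁻¹≡1) =
    trans (Σ-cong elements (λ a → χ-⇔ ((b ⊗ a) ≟ t) (a ≟ (b⁻¹ ⊗ t)) (solved a) (solution a)))
          (elements-count (b⁻¹ ⊗ t))
    where
    open ≡-Reasoning
    solved : ∀ a → b ⊗ a ≡ t → a ≡ b⁻¹ ⊗ t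
    solved a e = begin
      a              ≡⟨ ⊗-identityˡ a ⟨
      1# ⊗ a         ≡⟨ cong (_⊗ a) bb⁻¹≡1 ⟨
      (b ⊗ b⁻¹) ⊗ a  ≡⟨ solve 3 (λ b b⁻¹ a → (b :* b⁻¹) :* a := b⁻¹ :* (b :* a)) refl b b⁻¹ a ⟩
      b⁻¹ ⊗ (b ⊗ a)  ≡⟨ cong (b⁻¹ ⊗_) e ⟩
      b⁻¹ ⊗ t        ∎
    solution : ∀ a → a ≡ b⁻¹ ⊗ t → b ⊗ a ≡ t
    solution a e = begin
      b ⊗ a          ≡⟨ cong (b ⊗_) e ⟩
      b ⊗ (b⁻¹ ⊗ t)  ≡⟨ solve 3 (λ b b⁻¹ t → b :* (b⁻¹ :* t) := (b :* b⁻¹) :* t) refl b b⁻¹ t ⟩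
      (b ⊗ b⁻¹) ⊗ t  ≡⟨ cong (_⊗ t) bb⁻¹≡1 ⟩
      1# ⊗ t         ≡⟨ ⊗-identityˡ t ⟩
      t              ∎

  count-hyperplane : ∀ d (z : Pt F d) (t : Carrier) → ¬ z ≈ᵥ 0ᵥ →
                     q * Σ (space F d) (λ w → χ (z · w ≟ t)) ≡ q ^ d
  count-hyperplane zero    z t z≉0 = ⊥-elim (z≉0 (λ ()))
  count-hyperplane (suc d) z t z≉0 = begin
    q * Σ (space F (suc d)) (λ w → χ (z · w ≟ t))
      ≡⟨ cong (q *_) (Σ-allFuns elements d (λ w → χ (z · w ≟ t))) ⟩
    q * Σ elements (λ a → Σ (space F d) (λ v → χ (z · (a VF.∷ v) ≟ t)))
      ≡⟨ by-tail ((z ∘ fs) ≈ᵥ? 0ᵥ) ⟩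
    q * q ^ d ∎
    where
    open ≡-Reasoning
    z₀ = z fz
    z′ = z ∘ fs
    by-tail : Dec (z′ ≈ᵥ 0ᵥ) → q * Σ elements (λ a → Σ (space F d) (λ v → χ (z · (a VF.∷ v) ≟ t))) ≡ q * q ^ d
    by-tail (yes z′≈0) = cong (q *_) (begin
      Σ elements (λ a → Σ (space F d) (λ v → χ (z · (a VF.∷ v) ≟ t)))
        ≡⟨ Σ-cong elements (λ a → Σ-cong (space F d) (λ v → χ-⇔ (z · (a VF.∷ v) ≟ t) (z₀ ⊗ a ≟ t)
             (trans (sym (first-only a v))) (trans (first-only a v)))) ⟩
      Σ elements (λ a → Σ (space F d) (λ v → χ (z₀ ⊗ a ≟ t)))
        ≡⟨ Σ-cong elements (λ a → trans (Σ-const-* (space F d) _) (cong (χ (z₀ ⊗ a ≟ t) *_) (Σ-space-1 d))) ⟩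
      Σ elements (λ a → χ (z₀ ⊗ a ≟ t) * q ^ d)
        ≡⟨ Σ-*ʳ elements (q ^ d) (λ a → χ (z₀ ⊗ a ≟ t)) ⟩
      Σ elements (λ a → χ (z₀ ⊗ a ≟ t)) * q ^ d
        ≡⟨ cong (_* q ^ d) (count-linear z₀≢0 t) ⟩
      1ℤ * q ^ d
        ≡⟨ ZP.*-identityˡ _ ⟩
      q ^ d ∎)
      where
      z₀≢0 : ¬ z₀ ≡ 0#
      z₀≢0 z₀≡0 = z≉0 (λ { fz → z₀≡0 ; (fs i) → z′≈0 i })
      first-only : ∀ a v → z · (a VF.∷ v) ≡ z₀ ⊗ a
      first-only a v = trans (cong (z₀ ⊗ a ⊕_) (·-zeroˡ z′ v z′≈0)) (⊕-identityʳ _)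
    by-tail (no z′≉0) = begin
      q * Σ elements (λ a → Σ (space F d) (λ v → χ (z · (a VF.∷ v) ≟ t)))
        ≡⟨ Σ-*ˡ elements q _ ⟨
      Σ elements (λ a → q * Σ (space F d) (λ v → χ (z · (a VF.∷ v) ≟ t)))
        ≡⟨ Σ-cong elements (λ a → trans (cong (q *_) (Σ-cong (space F d) (λ v →
             χ-⇔ (z · (a VF.∷ v) ≟ t) (z′ · v ≟ t ⊝ z₀ ⊗ a) x+y≡z⇒y≡z-x y≡z-x⇒x+y≡z)))
             (count-hyperplane d z′ (t ⊝ z₀ ⊗ a) z′≉0)) ⟩
      Σ elements (λ a → q ^ d)
        ≡⟨ Σ-const-* elements (q ^ d) ⟩
      q ^ d * Σ elements (λ _ → 1ℤ)
        ≡⟨ cong (q ^ d *_) Σ-elements-1 ⟩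
      q ^ d * q
        ≡⟨ ZP.*-comm _ q ⟩
      q * q ^ d ∎

  -- ψ a = Σ_{r ≠ 0} e(r a) for any nontrivial additive character e; ψ-product is the
  -- corresponding identity, proved here by counting instead of with characters.
  ψ : Carrier → ℤ
  ψ a = q * χ (a ≟ 0#) - 1ℤ

  nonzero-zeros : Carrier → Carrier → ℤ
  nonzero-zeros a b = Σ elements (λ s → Σ elements (λ t → (χ≢0 s * χ≢0 t) * χ (s ⊗ a ⊕ t ⊗ b ≟ 0#)))

  nonzero-zeros-b≢0 : ∀ a {b} → ¬ b ≡ 0# → nonzero-zeros a b ≡ (q - 1ℤ) * (1ℤ - χ (a ≟ 0#))
  nonzero-zeros-b≢0 a {b} b≢0 =
    trans (Σ-cong elements (λ s → trans (Σ-cong elements (λ t → ZP.*-assoc (χ≢0 s) (χ≢0 t) _))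
                                        (Σ-*ˡ elements (χ≢0 s) _)))
          (Σ-χ≢0-* _ (1ℤ - χ (a ≟ 0#)) (λ s s≢0 → per-s s s≢0 (a ≟ 0#)))
    where
    per-s : ∀ s → ¬ s ≡ 0# → (D : Dec (a ≡ 0#)) →
            Σ elements (λ t → χ≢0 t * χ (s ⊗ a ⊕ t ⊗ b ≟ 0#)) ≡ 1ℤ - χ D
    per-s s s≢0 (yes a≡0) = trans (Σ-cong elements pointwise) (Σ-zero elements)
      where
      pointwise : ∀ t → χ≢0 t * χ (s ⊗ a ⊕ t ⊗ b ≟ 0#) ≡ 0ℤ
      pointwise t with t ≟ 0#
      ... | yes _   = refl
      ... | no t≢0  = cong (1ℤ *_) (χ-no (s ⊗ a ⊕ t ⊗ b ≟ 0#) (λ e → x≢0∧y≢0⇒x*y≢0 t≢0 b≢0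
                        (trans (solve 3 (λ s t b → t :* b := s :* con 0ℤ :+ t :* b) refl s t b)
                               (trans (cong (λ u → s ⊗ u ⊕ t ⊗ b) (sym a≡0)) e))))
    per-s s s≢0 (no a≢0) = trans (Σ-cong elements pointwise) (count-linear b≢0 (⊖ (s ⊗ a)))
      where
      pointwise : ∀ t → χ≢0 t * χ (s ⊗ a ⊕ t ⊗ b ≟ 0#) ≡ χ (b ⊗ t ≟ ⊖ (s ⊗ a))
      pointwise t with t ≟ 0#
      ... | yes t≡0 = sym (χ-no (b ⊗ t ≟ ⊖ (s ⊗ a)) (λ e → x≢0∧y≢0⇒x*y≢0 s≢0 a≢0
                        (-x≡0⇒x≡0 (trans (sym e) (trans (cong (b ⊗_) t≡0) (⊗-zeroʳ b))))))
      ... | no _    = trans (ZP.*-identityˡ _) (χ-⇔ (s ⊗ a ⊕ t ⊗ b ≟ 0#) (b ⊗ t ≟ ⊖ (s ⊗ a))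
                        (λ e → trans (⊗-comm b t) (trans (x+y≡z⇒y≡z-x e) (⊕-identityˡ _)))
                        (λ e → y≡z-x⇒x+y≡z (trans (⊗-comm t b) (trans e (sym (⊕-identityˡ _))))))

  nonzero-zeros-b≡0 : ∀ a {b} → b ≡ 0# → nonzero-zeros a b ≡ (q - 1ℤ) * ((q - 1ℤ) * χ (a ≟ 0#))
  nonzero-zeros-b≡0 a {b} b≡0 = begin
    nonzero-zeros a b
      ≡⟨ Σ-cong elements (λ s → Σ-cong elements (λ t → cong ((χ≢0 s * χ≢0 t) *_)
           (χ-⇔ (s ⊗ a ⊕ t ⊗ b ≟ 0#) (s ⊗ a ≟ 0#) (trans (sym (drop-b s t))) (trans (drop-b s t))))) ⟩
    Σ elements (λ s → Σ elements (λ t → (χ≢0 s * χ≢0 t) * χ (s ⊗ a ≟ 0#)))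
      ≡⟨ Σ-cong elements (λ s → trans (Σ-cong elements (λ t → reorder (χ≢0 s) (χ≢0 t) _))
                                      (Σ-*ˡ elements (χ≢0 s * χ (s ⊗ a ≟ 0#)) χ≢0)) ⟩
    Σ elements (λ s → χ≢0 s * χ (s ⊗ a ≟ 0#) * Σ elements χ≢0)
      ≡⟨ Σ-*ʳ elements _ (λ s → χ≢0 s * χ (s ⊗ a ≟ 0#)) ⟩
    Σ elements (λ s → χ≢0 s * χ (s ⊗ a ≟ 0#)) * Σ elements χ≢0
      ≡⟨ cong₂ _*_ (Σ-χ≢0-* _ (χ (a ≟ 0#)) (λ s s≢0 → χ-⇔ (s ⊗ a ≟ 0#) (a ≟ 0#)
                      (λ e → a≡0 s≢0 (x*y≡0⇒x≡0∨y≡0 e)) (λ e → trans (cong (s ⊗_) e) (⊗-zeroʳ s))))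
                   Σ-χ≢0 ⟩
    (q - 1ℤ) * χ (a ≟ 0#) * (q - 1ℤ)
      ≡⟨ ZP.*-comm _ (q - 1ℤ) ⟩
    (q - 1ℤ) * ((q - 1ℤ) * χ (a ≟ 0#)) ∎
    where
    open ≡-Reasoning
    reorder : ∀ x y z → x * y * z ≡ x * z * y
    reorder = solve-∀
    drop-b : ∀ s t → s ⊗ a ⊕ t ⊗ b ≡ s ⊗ a
    drop-b s t = trans (cong (λ u → s ⊗ a ⊕ t ⊗ u) b≡0) (trans (cong (s ⊗ a ⊕_) (⊗-zeroʳ t)) (⊕-identityʳ _))
    a≡0 : ∀ {s} → ¬ s ≡ 0# → s ≡ 0# ⊎ a ≡ 0# → a ≡ 0#
    a≡0 s≢0 (inj₁ s≡0) = ⊥-elim (s≢0 s≡0)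
    a≡0 s≢0 (inj₂ a≡0) = a≡0

  ψ-product : ∀ a b → (q - 1ℤ) * (ψ a * ψ b) ≡
              Σ elements (λ s → Σ elements (λ t → (χ≢0 s * χ≢0 t) * ψ (s ⊗ a ⊕ t ⊗ b)))
  ψ-product a b = begin
    (q - 1ℤ) * (ψ a * ψ b)
      ≡⟨ by-b (b ≟ 0#) ⟩
    q * nonzero-zeros a b - (q - 1ℤ) * (q - 1ℤ)
      ≡⟨ expand ⟨
    Σ elements (λ s → Σ elements (λ t → (χ≢0 s * χ≢0 t) * ψ (s ⊗ a ⊕ t ⊗ b))) ∎
    where
    open ≡-Reasoning
    by-b : (D : Dec (b ≡ 0#)) →
           (q - 1ℤ) * (ψ a * (q * χ D - 1ℤ)) ≡ q * nonzero-zeros a b - (q - 1ℤ) * (q - 1ℤ)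
    by-b (yes b≡0) = trans (collect q (χ (a ≟ 0#)))
                           (cong (λ u → q * u - (q - 1ℤ) * (q - 1ℤ)) (sym (nonzero-zeros-b≡0 a b≡0)))
      where
      collect : ∀ q A → (q - 1ℤ) * ((q * A - 1ℤ) * (q * 1ℤ - 1ℤ))
                        ≡ q * ((q - 1ℤ) * ((q - 1ℤ) * A)) - (q - 1ℤ) * (q - 1ℤ)
      collect = solve-∀
    by-b (no b≢0) = trans (collect q (χ (a ≟ 0#)))
                          (cong (λ u → q * u - (q - 1ℤ) * (q - 1ℤ)) (sym (nonzero-zeros-b≢0 a b≢0)))
      where
      collect : ∀ q A → (q - 1ℤ) * ((q * A - 1ℤ) * (q * 0ℤ - 1ℤ))
                        ≡ q * ((q - 1ℤ) * (1ℤ - A)) - (q - 1ℤ) * (q - 1ℤ)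
      collect = solve-∀
    distribute : ∀ q u v X → u * v * (q * X - 1ℤ) ≡ q * (u * v * X) - u * v
    distribute = solve-∀
    expand : Σ elements (λ s → Σ elements (λ t → (χ≢0 s * χ≢0 t) * ψ (s ⊗ a ⊕ t ⊗ b)))
             ≡ q * nonzero-zeros a b - (q - 1ℤ) * (q - 1ℤ)
    expand = begin
      Σ elements (λ s → Σ elements (λ t → (χ≢0 s * χ≢0 t) * ψ (s ⊗ a ⊕ t ⊗ b)))
        ≡⟨ Σ-cong elements (λ s → trans (Σ-cong elements (λ t → distribute q (χ≢0 s) (χ≢0 t) _))
             (trans (Σ-- elements _ _) (cong (_- Σ elements (λ t → χ≢0 s * χ≢0 t)) (Σ-*ˡ elements q _)))) ⟩
      Σ elements (λ s → q * Σ elements (λ t → (χ≢0 s * χ≢0 t) * χ (s ⊗ a ⊕ t ⊗ b ≟ 0#))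
                        - Σ elements (λ t → χ≢0 s * χ≢0 t))
        ≡⟨ Σ-- elements _ _ ⟩
      Σ elements (λ s → q * Σ elements (λ t → (χ≢0 s * χ≢0 t) * χ (s ⊗ a ⊕ t ⊗ b ≟ 0#)))
        - Σ elements (λ s → Σ elements (λ t → χ≢0 s * χ≢0 t))
        ≡⟨ cong₂ _-_ (Σ-*ˡ elements q _)
                     (trans (sym (Σ-*-Σ elements elements χ≢0 χ≢0)) (cong₂ _*_ Σ-χ≢0 Σ-χ≢0)) ⟩
      q * nonzero-zeros a b - (q - 1ℤ) * (q - 1ℤ) ∎

  module SphereEstimates {d : ℕ} (L : List (Pt F d)) (L-sphere : All (λ y → y · y ≡ 1#) L)
                         (L-distinct : Multiplicity.Distinct (≈ᵥ-decSetoid d) L) where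

    n : ℤ
    n = + length L

    0≤n : 0ℤ ≤ n
    0≤n = 0≤+ (length L)

    K : ℤ
    K = (q - 1ℤ) * q ^ d

    0≤K : 0ℤ ≤ K
    0≤K = 0≤-* 0≤q-1 (0≤-^ (0≤+ size) d)

    same-dot : Pt F d → Pt F d → Pt F d → ℤ
    same-dot x x′ w = χ (x · w ≟ x′ · w)

    φ : Pt F d → Pt F d → Pt F d → ℤ
    φ w x x′ = q * same-dot x x′ w - 1ℤ

    G : Pt F d → ℤ
    G w = Σ L (λ x → Σ L (λ x′ → φ w x x′))

    same-dot-sub : ∀ x x′ w → same-dot x x′ w ≡ χ ((x -ᵥ′ x′) · w ≟ 0#)
    same-dot-sub x x′ w = χ-⇔ (x · w ≟ x′ · w) ((x -ᵥ′ x′) · w ≟ 0#)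
      (λ e → trans (·-distribʳ-- x x′ w) (x≡y⇒x-y≡0 e))
      (λ e → x-y≡0⇒x≡y (trans (sym (·-distribʳ-- x x′ w)) e))

    G-resp : ∀ {v w} → v ≈ᵥ w → G v ≡ G w
    G-resp {v} {w} v≈w = Σ-cong L (λ x → Σ-cong L (λ x′ → cong (λ u → q * u - 1ℤ)
      (χ-⇔ (x · v ≟ x′ · v) (x · w ≟ x′ · w)
         (λ e → trans (·-cong (λ _ → refl) (≈ᵥ-sym v≈w)) (trans e (·-cong (λ _ → refl) v≈w)))
         (λ e → trans (·-cong (λ _ → refl) v≈w) (trans e (·-cong (λ _ → refl) (≈ᵥ-sym v≈w)))))))

    G-*ᵥ : ∀ {t} → ¬ t ≡ 0# → ∀ w → G (t *ᵥ w) ≡ G w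
    G-*ᵥ {t} t≢0 w = Σ-cong L (λ x → Σ-cong L (λ x′ → cong (λ u → q * u - 1ℤ)
      (χ-⇔ (x · (t *ᵥ w) ≟ x′ · (t *ᵥ w)) (x · w ≟ x′ · w)
         (λ e → ⊗-cancelˡ t≢0 (trans (sym (·-*ᵥʳ t x w)) (trans e (·-*ᵥʳ t x′ w))))
         (λ e → trans (·-*ᵥʳ t x w) (trans (cong (t ⊗_) e) (sym (·-*ᵥʳ t x′ w)))))))

    -- With S t = #{x ∈ L : x·w = t}, G w = q Σ_t (S t)² - (Σ_t S t)², which is ≥ 0 by Cauchy–Schwarz.
    0≤G : ∀ w → 0ℤ ≤ G w
    0≤G w = subst₂ _≤_ refl (sym G≡) (ZP.i≤j⇒0≤j-i
              (subst₂ _≤_ (cong₂ _*_ ΣS≡n ΣS≡n) (cong₂ _*_ length-elements ΣS²≡)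
                (Σ²≤length*Σsq elements S)))
      where
      open ≡-Reasoning
      S : Carrier → ℤ
      S t = Σ L (λ x → χ (x · w ≟ t))
      collisions : ℤ
      collisions = Σ L (λ x → Σ L (λ x′ → same-dot x x′ w))
      length-elements : + length elements ≡ q
      length-elements = trans (sym (Σ-1 elements)) Σ-elements-1
      ΣS≡n : Σ elements S ≡ n
      ΣS≡n = trans (Σ-swap elements L (λ t x → χ (x · w ≟ t)))
               (trans (Σ-cong L (λ x → trans (Σ-cong elements (λ t → Elements.χ-sym (x · w) t))
                                             (elements-count (x · w))))
                      (Σ-1 L))
      ΣS²≡ : Σ elements (λ t → S t * S t) ≡ collisions
      ΣS²≡ = Elements.Σ-collisions L (λ x → x · w)
      G≡ : G w ≡ q * collisions - n * n
      G≡ = begin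
        Σ L (λ x → Σ L (λ x′ → q * same-dot x x′ w - 1ℤ))
          ≡⟨ Σ-cong L (λ x → trans (Σ-- L (λ x′ → q * same-dot x x′ w) (λ _ → 1ℤ))
                                   (cong₂ _-_ (Σ-*ˡ L q (λ x′ → same-dot x x′ w)) (Σ-1 L))) ⟩
        Σ L (λ x → q * Σ L (λ x′ → same-dot x x′ w) - n)
          ≡⟨ Σ-- L (λ x → q * Σ L (λ x′ → same-dot x x′ w)) (λ _ → n) ⟩
        Σ L (λ x → q * Σ L (λ x′ → same-dot x x′ w)) - Σ L (λ _ → n)
          ≡⟨ cong₂ _-_ (Σ-*ˡ L q _) (Σ-const L n) ⟩
        q * collisions - n * n ∎

    Σ-space-φ : ∀ x x′ → Σ (space F d) (λ w → φ w x x′) ≡ χ (x′ ≈ᵥ? x) * K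
    Σ-space-φ x x′ = trans Σφ≡ (by-equality (x′ ≈ᵥ? x))
      where
      Σφ≡ : Σ (space F d) (λ w → φ w x x′) ≡ q * Σ (space F d) (same-dot x x′) - q ^ d
      Σφ≡ = trans (Σ-- (space F d) (λ w → q * same-dot x x′ w) (λ _ → 1ℤ))
                  (cong₂ _-_ (Σ-*ˡ (space F d) q _) (Σ-space-1 d))
      by-equality : (D : Dec (x′ ≈ᵥ x)) → q * Σ (space F d) (same-dot x x′) - q ^ d ≡ χ D * K
      by-equality (yes x′≈x) =
        trans (cong (λ u → q * u - q ^ d)
                (trans (Σ-cong (space F d) (λ w → χ-yes (x · w ≟ x′ · w) (·-cong (≈ᵥ-sym x′≈x) (λ _ → refl))))
                       (Σ-space-1 d)))
              (collect q (q ^ d))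
        where
        collect : ∀ q Q → q * Q - Q ≡ 1ℤ * ((q - 1ℤ) * Q)
        collect = solve-∀
      by-equality (no x′≉x) =
        trans (cong (_- q ^ d) (trans (cong (q *_) (Σ-cong (space F d) (same-dot-sub x x′)))
                (count-hyperplane d (x -ᵥ′ x′) 0# (λ z≈0 → x′≉x (λ i → sym (x-y≡0⇒x≡y (z≈0 i)))))))
              (trans (ZP.+-inverseʳ (q ^ d)) (sym (ZP.*-zeroˡ K)))

    Σ-space-G≤ : Σ (space F d) G ≤ K * n
    Σ-space-G≤ = begin
      Σ (space F d) G
        ≡⟨ reorder ⟨
      Σ L (λ x → Σ L (λ x′ → Σ (space F d) (λ w → φ w x x′)))
        ≡⟨ Σ-cong L (λ x → trans (Σ-cong L (λ x′ → Σ-space-φ x x′)) (Σ-*ʳ L K (λ x′ → χ (x′ ≈ᵥ? x)))) ⟩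
      Σ L (λ x → Σ L (λ x′ → χ (x′ ≈ᵥ? x)) * K)
        ≤⟨ Σ-mono L (λ x → *-monoʳ-≤-0≤ 0≤K (L-distinct x)) ⟩
      Σ L (λ _ → 1ℤ * K)
        ≡⟨ trans (Σ-cong L (λ _ → ZP.*-identityˡ K)) (trans (Σ-const L K) (ZP.*-comm n K)) ⟩
      K * n ∎
      where
      open ZP.≤-Reasoning
      reorder : Σ L (λ x → Σ L (λ x′ → Σ (space F d) (λ w → φ w x x′))) ≡ Σ (space F d) G
      reorder = trans (Σ-cong L (λ x → Σ-swap L (space F d) (λ x′ w → φ w x x′)))
                      (Σ-swap L (space F d) (λ x w → Σ L (λ x′ → φ w x x′)))

    -- A line through the origin meets the unit sphere in at most two points: t y = u forces
    -- t² = ‖u‖, and then y = t⁻¹ u.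
    line∩sphere≤2 : ∀ u → Σ L (λ y → Σ elements (λ t → χ≢0 t * χ (t *ᵥ y ≈ᵥ? u))) ≤ + 2
    line∩sphere≤2 u =
      ZP.≤-trans (subst₂ _≤_ (Σ-swap elements L (λ t y → χ≢0 t * χ (t *ᵥ y ≈ᵥ? u))) refl
                   (Σ-mono elements (λ t → per-scalar t (t ≟ 0#) (t ⊗ t ≟ u · u))))
                 (count-square-roots≤2 (u · u))
      where
      per-scalar : ∀ t → Dec (t ≡ 0#) → (D : Dec (t ⊗ t ≡ u · u)) →
                   Σ L (λ y → χ≢0 t * χ (t *ᵥ y ≈ᵥ? u)) ≤ χ D
      per-scalar t (yes t≡0) D =
        subst₂ _≤_ (sym (trans (Σ-cong L (λ y → cong (_* χ (t *ᵥ y ≈ᵥ? u)) (χ≢0-≡0 t≡0)))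
                               (Σ-zero L)))
                   refl (0≤χ D)
      per-scalar t (no t≢0) (yes t²≡‖u‖) =
        subst₂ _≤_ (sym (Σ-cong L (λ y → trans (cong (_* χ (t *ᵥ y ≈ᵥ? u)) (χ≢0-≢0 t≢0))
                                               (ZP.*-identityˡ _))))
                   refl
          (Multiplicity.count≤1 (≈ᵥ-decSetoid d) (λ y → t *ᵥ y ≈ᵥ? u) L L-distinct
             (λ y y′ ty≈u ty′≈u i → ⊗-cancelˡ t≢0 (trans (ty≈u i) (sym (ty′≈u i)))))
      per-scalar t (no t≢0) (no t²≢‖u‖) =
        subst₂ _≤_ (sym (trans (Σ-congᴬ L L-sphere off-line) (Σ-zero L))) refl (0≤+ 0)
        where
        open ≡-Reasoning
        off-line : ∀ y → y · y ≡ 1# → χ≢0 t * χ (t *ᵥ y ≈ᵥ? u) ≡ 0ℤ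
        off-line y ‖y‖≡1 = cong₂ _*_ (χ≢0-≢0 t≢0) (χ-no (t *ᵥ y ≈ᵥ? u) (λ ty≈u → t²≢‖u‖ (sym (begin
          u · u                  ≡⟨ ·-cong (≈ᵥ-sym ty≈u) (≈ᵥ-sym ty≈u) ⟩
          (t *ᵥ y) · (t *ᵥ y)    ≡⟨ ‖*ᵥ‖ t y ⟩
          (t ⊗ t) ⊗ y · y        ≡⟨ cong ((t ⊗ t) ⊗_) ‖y‖≡1 ⟩
          (t ⊗ t) ⊗ 1#           ≡⟨ ⊗-identityʳ _ ⟩
          t ⊗ t                  ∎))))

    -- Each w is t y (t ≠ 0, y ∈ L) in at most two ways, and G (t y) = G y.
    Σ-sphere-G≤ : Σ L G ≤ + 2 * (q ^ d * n)
    Σ-sphere-G≤ = *-cancelˡ-≤-1≤ 1≤q-1 (subst₂ _≤_ rescaled (collect (q - 1ℤ) (q ^ d) n) fibred)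
      where
      collect : ∀ a Q m → + 2 * ((a * Q) * m) ≡ a * (+ 2 * (Q * m))
      collect = solve-∀
      rescaled : Σ L (λ y → Σ elements (λ t → χ≢0 t * G (t *ᵥ y))) ≡ (q - 1ℤ) * Σ L G
      rescaled = trans (Σ-cong L (λ y → Σ-χ≢0-* (λ t → G (t *ᵥ y)) (G y) (λ t t≢0 → G-*ᵥ t≢0 y)))
                       (Σ-*ˡ L (q - 1ℤ) G)
      fibred : Σ L (λ y → Σ elements (λ t → χ≢0 t * G (t *ᵥ y))) ≤ + 2 * (K * n)
      fibred = subst₂ _≤_ (Σ-pairs L elements (λ p → χ≢0 (proj₂ p) * G (proj₂ p *ᵥ proj₁ p))) refl
        (ZP.≤-trans
          (Space.Σ-fibres-≤ d G G-resp 0≤G (pairs L elements) (χ≢0 ∘ proj₂) (λ p → proj₂ p *ᵥ proj₁ p) (+ 2)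
            (λ w → subst₂ _≤_ (sym (Σ-pairs L elements (λ p → χ≢0 (proj₂ p) * χ (proj₂ p *ᵥ proj₁ p ≈ᵥ? w))))
                               refl (line∩sphere≤2 w)))
          (*-monoˡ-≤-0≤ (0≤+ 2) Σ-space-G≤))

    φ≡ψ : ∀ w x x′ → φ w x x′ ≡ ψ ((x -ᵥ′ x′) · w)
    φ≡ψ w x x′ = cong (λ u → q * u - 1ℤ) (same-dot-sub x x′ w)

    H : Pt F d → Pt F d → ℤ
    H y y′ = Σ L (λ x → Σ L (λ x′ → φ y x x′ * φ y′ x x′))

    G-product : ∀ y y′ → (q - 1ℤ) * H y y′ ≡
                Σ elements (λ s → Σ elements (λ t → (χ≢0 s * χ≢0 t) * G (s *ᵥ y +ᵥ t *ᵥ y′)))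
    G-product y y′ = begin
      (q - 1ℤ) * H y y′
        ≡⟨ trans (sym (Σ-*ˡ L (q - 1ℤ) _)) (Σ-cong L (λ x → sym (Σ-*ˡ L (q - 1ℤ) _))) ⟩
      Σ L (λ x → Σ L (λ x′ → (q - 1ℤ) * (φ y x x′ * φ y′ x x′)))
        ≡⟨ Σ-cong L (λ x → Σ-cong L (λ x′ → pointwise x x′)) ⟩
      Σ L (λ x → Σ L (λ x′ → Σ elements (λ s → Σ elements (λ t →
        (χ≢0 s * χ≢0 t) * φ (s *ᵥ y +ᵥ t *ᵥ y′) x x′))))
        ≡⟨ Σ-swap-pairs L L elements elements (λ x x′ s t → (χ≢0 s * χ≢0 t) * φ (s *ᵥ y +ᵥ t *ᵥ y′) x x′) ⟩
      Σ elements (λ s → Σ elements (λ t → Σ L (λ x → Σ L (λ x′ →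
        (χ≢0 s * χ≢0 t) * φ (s *ᵥ y +ᵥ t *ᵥ y′) x x′))))
        ≡⟨ Σ-cong elements (λ s → Σ-cong elements (λ t →
             trans (Σ-cong L (λ x → Σ-*ˡ L (χ≢0 s * χ≢0 t) _)) (Σ-*ˡ L (χ≢0 s * χ≢0 t) _))) ⟩
      Σ elements (λ s → Σ elements (λ t → (χ≢0 s * χ≢0 t) * G (s *ᵥ y +ᵥ t *ᵥ y′))) ∎
      where
      open ≡-Reasoning
      pointwise : ∀ x x′ → (q - 1ℤ) * (φ y x x′ * φ y′ x x′) ≡
                  Σ elements (λ s → Σ elements (λ t → (χ≢0 s * χ≢0 t) * φ (s *ᵥ y +ᵥ t *ᵥ y′) x x′))
      pointwise x x′ = begin
        (q - 1ℤ) * (φ y x x′ * φ y′ x x′)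
          ≡⟨ cong ((q - 1ℤ) *_) (cong₂ _*_ (φ≡ψ y x x′) (φ≡ψ y′ x x′)) ⟩
        (q - 1ℤ) * (ψ (z · y) * ψ (z · y′))
          ≡⟨ ψ-product (z · y) (z · y′) ⟩
        Σ elements (λ s → Σ elements (λ t → (χ≢0 s * χ≢0 t) * ψ (s ⊗ z · y ⊕ t ⊗ z · y′)))
          ≡⟨ Σ-cong elements (λ s → Σ-cong elements (λ t → cong ((χ≢0 s * χ≢0 t) *_)
               (trans (cong ψ (sym (linear s t))) (sym (φ≡ψ (s *ᵥ y +ᵥ t *ᵥ y′) x x′))))) ⟩
        Σ elements (λ s → Σ elements (λ t → (χ≢0 s * χ≢0 t) * φ (s *ᵥ y +ᵥ t *ᵥ y′) x x′)) ∎
        where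
        z = x -ᵥ′ x′
        linear : ∀ s t → z · (s *ᵥ y +ᵥ t *ᵥ y′) ≡ s ⊗ z · y ⊕ t ⊗ z · y′
        linear s t = trans (·-distribˡ-+ᵥ z (s *ᵥ y) (t *ᵥ y′)) (cong₂ _⊕_ (·-*ᵥʳ s z y) (·-*ᵥʳ t z y′))

    D : Pt F d → Pt F d → ℤ
    D x x′ = Σ L (λ y → φ y x x′)

    -- For fixed y and s ≠ 0, w = s y + t y′ forces t y′ = w - s y, a point of a line through 0.
    plane-fibre≤ : ∀ w → Σ L (λ y → Σ elements (λ s → Σ L (λ y′ → Σ elements (λ t →
                     (χ≢0 s * χ≢0 t) * χ (s *ᵥ y +ᵥ t *ᵥ y′ ≈ᵥ? w))))) ≤ n * ((q - 1ℤ) * + 2)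
    plane-fibre≤ w = subst₂ _≤_ refl (trans (Σ-const L _) refl)
      (Σ-mono L (λ y → subst₂ _≤_ refl (trans (Σ-*ʳ elements (+ 2) χ≢0) (cong (_* + 2) Σ-χ≢0))
        (Σ-mono elements (λ s → subst₂ _≤_ (sym (factor y s)) refl
          (*-monoˡ-≤-0≤ (0≤χ (¬? (s ≟ 0#))) (line∩sphere≤2 (w -ᵥ′ s *ᵥ y)))))))
      where
      reassoc : ∀ a b c → (a * b) * c ≡ a * (b * c)
      reassoc = solve-∀
      factor : ∀ y s → Σ L (λ y′ → Σ elements (λ t → (χ≢0 s * χ≢0 t) * χ (s *ᵥ y +ᵥ t *ᵥ y′ ≈ᵥ? w)))
                     ≡ χ≢0 s * Σ L (λ y′ → Σ elements (λ t → χ≢0 t * χ (t *ᵥ y′ ≈ᵥ? (w -ᵥ′ s *ᵥ y))))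
      factor y s = trans (Σ-cong L (λ y′ → trans (Σ-cong elements (λ t → trans (reassoc (χ≢0 s) (χ≢0 t) _)
                          (cong (λ u → χ≢0 s * (χ≢0 t * u))
                            (χ-⇔ (s *ᵥ y +ᵥ t *ᵥ y′ ≈ᵥ? w) (t *ᵥ y′ ≈ᵥ? (w -ᵥ′ s *ᵥ y))
                               (λ e i → x+y≡z⇒y≡z-x (e i)) (λ e i → y≡z-x⇒x+y≡z (e i))))))
                       (Σ-*ˡ elements (χ≢0 s) _)))
                   (Σ-*ˡ L (χ≢0 s) _)

    quads : List ((Pt F d × Carrier) × (Pt F d × Carrier))
    quads = pairs (pairs L elements) (pairs L elements)

    Σ-quads : ∀ (f : (Pt F d × Carrier) × (Pt F d × Carrier) → ℤ) →
      Σ quads f ≡ Σ L (λ y → Σ elements (λ s → Σ L (λ y′ → Σ elements (λ t → f ((y , s) , (y′ , t))))))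
    Σ-quads f = trans (Σ-pairs (pairs L elements) (pairs L elements) f)
      (trans (Σ-pairs L elements (λ p → Σ (pairs L elements) (λ p′ → f (p , p′))))
        (Σ-cong L (λ y → Σ-cong elements (λ s → Σ-pairs L elements (λ p′ → f ((y , s) , p′))))))

    weight : (Pt F d × Carrier) × (Pt F d × Carrier) → ℤ
    weight ((_ , s) , (_ , t)) = χ≢0 s * χ≢0 t

    point : (Pt F d × Carrier) × (Pt F d × Carrier) → Pt F d
    point ((y , s) , (y′ , t)) = s *ᵥ y +ᵥ t *ᵥ y′

    Σ-quads-G≡ : Σ quads (λ p → weight p * G (point p)) ≡ (q - 1ℤ) * Σ L (λ x → Σ L (λ x′ → D x x′ * D x x′))
    Σ-quads-G≡ = begin
      Σ quads (λ p → weight p * G (point p))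
        ≡⟨ Σ-quads (λ p → weight p * G (point p)) ⟩
      Σ L (λ y → Σ elements (λ s → Σ L (λ y′ → Σ elements (λ t → (χ≢0 s * χ≢0 t) * G (s *ᵥ y +ᵥ t *ᵥ y′)))))
        ≡⟨ Σ-cong L (λ y → sym (Σ-swap L elements (λ y′ s → Σ elements (λ t →
             (χ≢0 s * χ≢0 t) * G (s *ᵥ y +ᵥ t *ᵥ y′))))) ⟩
      Σ L (λ y → Σ L (λ y′ → Σ elements (λ s → Σ elements (λ t → (χ≢0 s * χ≢0 t) * G (s *ᵥ y +ᵥ t *ᵥ y′)))))
        ≡⟨ Σ-cong L (λ y → Σ-cong L (λ y′ → sym (G-product y y′))) ⟩
      Σ L (λ y → Σ L (λ y′ → (q - 1ℤ) * H y y′))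
        ≡⟨ trans (Σ-cong L (λ y → Σ-*ˡ L (q - 1ℤ) (H y))) (Σ-*ˡ L (q - 1ℤ) _) ⟩
      (q - 1ℤ) * Σ L (λ y → Σ L (λ y′ → H y y′))
        ≡⟨ cong ((q - 1ℤ) *_) (sym (Σ-swap-pairs L L L L (λ x x′ y y′ → φ y x x′ * φ y′ x x′))) ⟩
      (q - 1ℤ) * Σ L (λ x → Σ L (λ x′ → Σ L (λ y → Σ L (λ y′ → φ y x x′ * φ y′ x x′))))
        ≡⟨ cong ((q - 1ℤ) *_) (Σ-cong L (λ x → Σ-cong L (λ x′ →
             sym (Σ-*-Σ L L (λ y → φ y x x′) (λ y′ → φ y′ x x′))))) ⟩
      (q - 1ℤ) * Σ L (λ x → Σ L (λ x′ → D x x′ * D x x′)) ∎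
      where open ≡-Reasoning

    Σ-D²≤ : Σ L (λ x → Σ L (λ x′ → D x x′ * D x x′)) ≤ + 2 * n * (K * n)
    Σ-D²≤ = *-cancelˡ-≤-1≤ 1≤q-1 (subst₂ _≤_ Σ-quads-G≡ (collect (q - 1ℤ) n K)
      (ZP.≤-trans
        (Space.Σ-fibres-≤ d G G-resp 0≤G quads weight point (n * ((q - 1ℤ) * + 2))
          (λ w → subst₂ _≤_ (sym (Σ-quads (λ p → weight p * χ (point p ≈ᵥ? w)))) refl (plane-fibre≤ w)))
        (*-monoˡ-≤-0≤ (0≤-* 0≤n (0≤-* 0≤q-1 (0≤+ 2))) Σ-space-G≤)))
      where
      collect : ∀ a m k → m * (a * + 2) * (k * m) ≡ a * (+ 2 * m * (k * m))
      collect = solve-∀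

    N : Pt F d → Pt F d → ℤ
    N x x′ = Σ L (same-dot x x′)

    0≤N : ∀ x x′ → 0ℤ ≤ N x x′
    0≤N x x′ = 0≤Σ L (λ y → 0≤χ (x · y ≟ x′ · y))

    N≤n : ∀ x x′ → N x x′ ≤ n
    N≤n x x′ = subst₂ _≤_ refl (Σ-1 L) (Σ-mono L (λ y → χ≤1 (x · y ≟ x′ · y)))

    qN≡D+n : ∀ x x′ → q * N x x′ ≡ D x x′ + n
    qN≡D+n x x′ = begin
      q * N x x′                      ≡⟨ Σ-*ˡ L q (same-dot x x′) ⟨
      Σq                              ≡⟨ cancel Σq n ⟩
      Σq - n + n                      ≡⟨ cong (λ u → Σq - u + n) (Σ-1 L) ⟨
      Σq - Σ L (λ _ → 1ℤ) + n         ≡⟨ cong (_+ n) (Σ-- L (λ y → q * same-dot x x′ y) (λ _ → 1ℤ)) ⟨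
      D x x′ + n                      ∎
      where
      open ≡-Reasoning
      Σq = Σ L (λ y → q * same-dot x x′ y)
      cancel : ∀ a n → a ≡ a - n + n
      cancel = solve-∀

    ΣD≡ΣG : Σ L (λ x → Σ L (D x)) ≡ Σ L G
    ΣD≡ΣG = trans (Σ-cong L (λ x → Σ-swap L L (λ x′ y → φ y x x′))) (Σ-swap L L (λ x y → Σ L (λ x′ → φ y x x′)))

    qΣN≤ : q * Σ L (λ x → Σ L (N x)) ≤ + 2 * (q ^ d * n) + n * (n * n)
    qΣN≤ = subst₂ _≤_ (sym Σ-qN≡) refl (ZP.+-mono-≤ Σ-sphere-G≤ ZP.≤-refl)
      where
      open ≡-Reasoning
      Σ-qN≡ : q * Σ L (λ x → Σ L (N x)) ≡ Σ L G + n * (n * n)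
      Σ-qN≡ = begin
        q * Σ L (λ x → Σ L (N x))
          ≡⟨ trans (sym (Σ-*ˡ L q _)) (Σ-cong L (λ x → sym (Σ-*ˡ L q _))) ⟩
        Σ L (λ x → Σ L (λ x′ → q * N x x′))
          ≡⟨ Σ-cong L (λ x → trans (Σ-cong L (qN≡D+n x)) (Σ-+ L (D x) (λ _ → n))) ⟩
        Σ L (λ x → Σ L (D x) + Σ L (λ _ → n))
          ≡⟨ Σ-+ L (λ x → Σ L (D x)) (λ _ → Σ L (λ _ → n)) ⟩
        Σ L (λ x → Σ L (D x)) + Σ L (λ _ → Σ L (λ _ → n))
          ≡⟨ cong₂ _+_ ΣD≡ΣG (trans (Σ-const L _) (cong (n *_) (Σ-const L n))) ⟩
        Σ L G + n * (n * n) ∎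

    Σ[qN]^k≤ : ∀ j → Σ L (λ x → Σ L (λ x′ → (q * N x x′) ^ (2 ℕ.+ j)))
                          ≤ (+ 2) ^ (2 ℕ.+ j) * (n * (n * n ^ (2 ℕ.+ j)) + (q * n) ^ j * (+ 2 * n * (K * n)))
    Σ[qN]^k≤ j = begin
      Σ L (λ x → Σ L (λ x′ → (q * N x x′) ^ k))
        ≤⟨ Σ-mono L (λ x → Σ-mono L (λ x′ → subst₂ _≤_ refl
             (cong (λ u → 2ᵏ * (n ^ k + (q * n) ^ j * (u * u))) (D≡ x x′))
             (^-≤-split (q * N x x′) n q j (0≤-* (0≤+ size) (0≤N x x′)) 0≤n (0≤+ size)
                        (*-monoˡ-≤-0≤ (0≤+ size) (N≤n x x′))))) ⟩
      Σ L (λ x → Σ L (λ x′ → 2ᵏ * (n ^ k + (q * n) ^ j * (D x x′ * D x x′))))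
        ≡⟨ regroup ⟩
      2ᵏ * (n * (n * n ^ k) + (q * n) ^ j * Σ L (λ x → Σ L (λ x′ → D x x′ * D x x′)))
        ≤⟨ *-monoˡ-≤-0≤ (0≤-^ (0≤+ 2) k) (ZP.+-mono-≤ (ZP.≤-refl {n * (n * n ^ k)})
             (*-monoˡ-≤-0≤ (0≤-^ (0≤-* (0≤+ size) 0≤n) j) Σ-D²≤)) ⟩
      2ᵏ * (n * (n * n ^ k) + (q * n) ^ j * (+ 2 * n * (K * n))) ∎
      where
      open ZP.≤-Reasoning
      k = 2 ℕ.+ j
      2ᵏ = (+ 2) ^ k
      D≡ : ∀ x x′ → q * N x x′ - n ≡ D x x′
      D≡ x x′ = trans (cong (_- n) (qN≡D+n x x′)) (cancel (D x x′) n)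
        where
        cancel : ∀ a b → a + b - b ≡ a
        cancel = solve-∀
      regroup : Σ L (λ x → Σ L (λ x′ → 2ᵏ * (n ^ k + (q * n) ^ j * (D x x′ * D x x′))))
                ≡ 2ᵏ * (n * (n * n ^ k) + (q * n) ^ j * Σ L (λ x → Σ L (λ x′ → D x x′ * D x x′)))
      regroup =
        trans (trans (Σ-cong L (λ x → Σ-*ˡ L 2ᵏ _)) (Σ-*ˡ L 2ᵏ _))
          (cong (2ᵏ *_) (trans (Σ-cong L (λ x → trans (Σ-+ L (λ _ → n ^ k) _)
                                 (cong₂ _+_ (Σ-const L (n ^ k)) (Σ-*ˡ L ((q * n) ^ j) _))))
                         (trans (Σ-+ L (λ _ → n * n ^ k) _)
                                (cong₂ _+_ (Σ-const L (n * n ^ k)) (Σ-*ˡ L ((q * n) ^ j) _)))))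

    closing-bound-1 : + 2 * (q ^ d * n) + n * (n * n) ≤ (+ 2) ^ 2 * (n ^ 3 + q ^ ((d ℕ.∸ 1) ℕ.+ 1) * n ^ 1)
    closing-bound-1 = begin
      + 2 * (q ^ d * n) + n * (n * n)
        ≤⟨ ZP.+-mono-≤ (*-monoˡ-≤-0≤ (0≤+ 2) (*-monoʳ-≤-0≤ 0≤n q^d≤P)) ZP.≤-refl ⟩
      + 2 * (P * n) + n * (n * n)
        ≤⟨ ZP.0≤i-j⇒j≤i (subst₂ _≤_ refl (sym (slack n P))
             (ZP.+-mono-≤ (0≤-* (0≤+ 3) (0≤-* 0≤n (0≤-* 0≤n 0≤n)))
                          (0≤-* (0≤+ 2) (0≤-* (0≤-^ (0≤+ size) ((d ℕ.∸ 1) ℕ.+ 1)) 0≤n)))) ⟩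
      (+ 2) ^ 2 * (n ^ 3 + P * n ^ 1) ∎
      where
      open ZP.≤-Reasoning
      P = q ^ ((d ℕ.∸ 1) ℕ.+ 1)
      q^d≤P : q ^ d ≤ P
      q^d≤P = ^-monoʳ-≤ 1≤q (subst (ℕ._≤ (d ℕ.∸ 1) ℕ.+ 1) (ℕP.+-identityʳ d) (+-≤-∸1+suc d 0))
      slack : ∀ n p → + 2 * (+ 2 * 1ℤ) * (n * (n * (n * 1ℤ)) + p * (n * 1ℤ)) - (+ 2 * (p * n) + n * (n * n))
                      ≡ + 3 * (n * (n * n)) + + 2 * (p * n)
      slack = solve-∀

    K*q^j≤q^[d∸1+2+j] : ∀ j → K * q ^ j ≤ q ^ ((d ℕ.∸ 1) ℕ.+ (2 ℕ.+ j))
    K*q^j≤q^[d∸1+2+j] j =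
      ZP.≤-trans (subst₂ _≤_ (sym (ZP.*-assoc (q - 1ℤ) (q ^ d) (q ^ j))) refl
                   (*-monoʳ-≤-0≤ (0≤-* (0≤q^ d) (0≤q^ j)) q-1≤q))
        (subst₂ _≤_ (cong (q *_) (ZP.^-distribˡ-+-* q d j)) refl
          (^-monoʳ-≤ 1≤q (subst (ℕ._≤ (d ℕ.∸ 1) ℕ.+ (2 ℕ.+ j)) (ℕP.+-suc d j) (+-≤-∸1+suc d (suc j)))))
      where
      0≤q^ : ∀ m → 0ℤ ≤ q ^ m
      0≤q^ = 0≤-^ (0≤+ size)

    closing-bound-2+ : ∀ j → let k = 2 ℕ.+ j in
      (+ 2) ^ k * (n * (n * n ^ k) + (q * n) ^ j * (+ 2 * n * (K * n)))
        ≤ (+ 2) ^ suc k * (n ^ (k ℕ.+ 2) + q ^ ((d ℕ.∸ 1) ℕ.+ k) * n ^ k)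
    closing-bound-2+ j = begin
      2ᵏ * (n * (n * n ^ k) + (q * n) ^ j * (+ 2 * n * (K * n)))
        ≤⟨ *-monoˡ-≤-0≤ 0≤2ᵏ (ZP.+-mono-≤ (ZP.≤-reflexive head≡) tail≤) ⟩
      2ᵏ * (A + + 2 * B)
        ≤⟨ *-monoˡ-≤-0≤ 0≤2ᵏ A+2B≤2[A+B] ⟩
      2ᵏ * (+ 2 * (A + B))
        ≡⟨ reassoc 2ᵏ (A + B) ⟩
      + 2 * 2ᵏ * (A + B) ∎
      where
      open ZP.≤-Reasoning
      k = 2 ℕ.+ j
      2ᵏ = (+ 2) ^ k
      P = q ^ ((d ℕ.∸ 1) ℕ.+ k)
      A = n ^ (k ℕ.+ 2)
      B = P * n ^ k
      0≤2ᵏ : 0ℤ ≤ 2ᵏ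
      0≤2ᵏ = 0≤-^ (0≤+ 2) k
      head≡ : n * (n * n ^ k) ≡ A
      head≡ = trans (commute n (n ^ k)) (sym (ZP.^-distribˡ-+-* n k 2))
        where
        commute : ∀ n x → n * (n * x) ≡ x * (n * (n * 1ℤ))
        commute = solve-∀
      tail≤ : (q * n) ^ j * (+ 2 * n * (K * n)) ≤ + 2 * B
      tail≤ = subst₂ _≤_ (sym (trans (cong (_* (+ 2 * n * (K * n))) (^-distribʳ-* q n j))
                                     (regroup K n (q ^ j) (n ^ j))))
                         refl
                (*-monoˡ-≤-0≤ (0≤+ 2) (*-monoʳ-≤-0≤ (0≤-^ 0≤n k) (K*q^j≤q^[d∸1+2+j] j)))
        where
        regroup : ∀ K n Qj nj → Qj * nj * (+ 2 * n * (K * n)) ≡ + 2 * (K * Qj * (n * (n * nj)))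
        regroup = solve-∀
      A+2B≤2[A+B] : A + + 2 * B ≤ + 2 * (A + B)
      A+2B≤2[A+B] = ZP.0≤i-j⇒j≤i (subst₂ _≤_ refl (sym (slack A B)) (0≤-^ 0≤n (k ℕ.+ 2)))
        where
        slack : ∀ A B → + 2 * (A + B) - (A + + 2 * B) ≡ A
        slack = solve-∀
      reassoc : ∀ x y → x * (+ 2 * y) ≡ + 2 * x * y
      reassoc = solve-∀

    weighted-energy≤ : ∀ k → 1 ℕ.≤ k → q ^ k * Σ L (λ x → Σ L (λ x′ → N x x′ ^ k))
                       ≤ (+ 2) ^ suc k * (n ^ (k ℕ.+ 2) + q ^ ((d ℕ.∸ 1) ℕ.+ k) * n ^ k)
    weighted-energy≤ (suc zero) _ = begin
      q ^ 1 * Σ L (λ x → Σ L (λ x′ → N x x′ ^ 1))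
        ≡⟨ cong₂ _*_ (ZP.*-identityʳ q) (Σ-cong L (λ x → Σ-cong L (λ x′ → ZP.*-identityʳ (N x x′)))) ⟩
      q * Σ L (λ x → Σ L (N x))
        ≤⟨ qΣN≤ ⟩
      + 2 * (q ^ d * n) + n * (n * n)
        ≤⟨ closing-bound-1 ⟩
      (+ 2) ^ 2 * (n ^ 3 + q ^ ((d ℕ.∸ 1) ℕ.+ 1) * n ^ 1) ∎
      where open ZP.≤-Reasoning
    weighted-energy≤ (suc (suc j)) _ = begin
      q ^ k * Σ L (λ x → Σ L (λ x′ → N x x′ ^ k))
        ≡⟨ trans (sym (Σ-*ˡ L (q ^ k) _)) (Σ-cong L (λ x → trans (sym (Σ-*ˡ L (q ^ k) _))
             (Σ-cong L (λ x′ → sym (^-distribʳ-* q (N x x′) k))))) ⟩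
      Σ L (λ x → Σ L (λ x′ → (q * N x x′) ^ k))
        ≤⟨ Σ[qN]^k≤ j ⟩
      (+ 2) ^ k * (n * (n * n ^ k) + (q * n) ^ j * (+ 2 * n * (K * n)))
        ≤⟨ closing-bound-2+ j ⟩
      (+ 2) ^ suc k * (n ^ (k ℕ.+ 2) + q ^ ((d ℕ.∸ 1) ℕ.+ k) * n ^ k) ∎
      where
      open ZP.≤-Reasoning
      k = 2 ℕ.+ j

  -- Σ_s ν(s)² counts pairs x, x′ ∈ E with ‖x - y^j‖ = ‖x′ - y^j‖ for all j; on the sphere that
  -- means x·y^j = x′·y^j, so summing over y^1 … y^k ∈ E gives Σ_{x,x′} N(x,x′)^k.
  energy≡ΣN^k : OddChar F → ∀ {d} k (E : Pt F d → Bool) → All (λ y → y · y ≡ 1#) (elemsOf F E) →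
    let L = elemsOf F E in
    + energy F k E ≡ Σ L (λ x → Σ L (λ x′ → Σ L (λ y → χ (x · y ≟ x′ · y)) ^ k))
  energy≡ΣN^k odd k E L-sphere = begin
    + energy F k E
      ≡⟨ +sum≡Σ _ (allFuns L k) ⟩
    Σ (allFuns L k) (λ ys → + sum (map (λ s → ν F E ys s ℕ.* ν F E ys s) (space F k)))
      ≡⟨ Σ-cong (allFuns L k) (λ ys → trans (+sum≡Σ _ (space F k))
           (Σ-cong (space F k) (λ s → ZP.pos-* (ν F E ys s) (ν F E ys s)))) ⟩
    Σ (allFuns L k) (λ ys → Σ (space F k) (λ s → + ν F E ys s * + ν F E ys s))
      ≡⟨ Σ-cong (allFuns L k) (λ ys → trans
           (Σ-cong (space F k) (λ s → cong₂ _*_ (length-filter _ L) (length-filter _ L)))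
           (Space.Σ-collisions k L (λ x j → dist x (ys j)))) ⟩
    Σ (allFuns L k) (λ ys → Σ L (λ x → Σ L (λ x′ → χ ((λ j → dist x (ys j)) ≈ᵥ? (λ j → dist x′ (ys j))))))
      ≡⟨ trans (Σ-swap (allFuns L k) L _) (Σ-cong L (λ x → Σ-swap (allFuns L k) L _)) ⟩
    Σ L (λ x → Σ L (λ x′ → Σ (allFuns L k) (λ ys → χ ((λ j → dist x (ys j)) ≈ᵥ? (λ j → dist x′ (ys j))))))
      ≡⟨ Σ-cong L (λ x → Σ-cong L (λ x′ → Σ-allFuns-all L (λ y → dist x y ≟ dist x′ y) k)) ⟩
    Σ L (λ x → Σ L (λ x′ → Σ L (λ y → χ (dist x y ≟ dist x′ y)) ^ k))
      ≡⟨ Σ-congᴬ L L-sphere (λ x ‖x‖≡1 → Σ-congᴬ L L-sphere (λ x′ ‖x′‖≡1 → cong (_^ k)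
           (Σ-cong L (λ y → uncurry (χ-⇔ (dist x y ≟ dist x′ y) (x · y ≟ x′ · y))
                              (equidistant⇔same-dot odd x x′ y ‖x‖≡1 ‖x′‖≡1))))) ⟩
    Σ L (λ x → Σ L (λ x′ → Σ L (λ y → χ (x · y ≟ x′ · y)) ^ k)) ∎
    where
    open ≡-Reasoning
    L = elemsOf F E
    dist : ∀ {d} → Pt F d → Pt F d → Carrier
    dist x y = (x -ᵥ′ y) · (x -ᵥ′ y)

lemma12p1 : (d k : ℕ) → 1 ℕ.≤ k → ∃ λ (C : ℕ) →
    (F : FiniteField) → OddChar F →
    (E : Pt F d → Bool) → (∀ x → T (E x) → ‖_‖ F x ≡ FiniteField.1# F) →
    FiniteField.size F ℕ.^ k ℕ.* energy F k E
      ℕ.≤ C ℕ.* (card F E ℕ.^ (k ℕ.+ 2) ℕ.+ FiniteField.size F ℕ.^ ((d ℕ.∸ 1) ℕ.+ k) ℕ.* card F E ℕ.^ k)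
lemma12p1 d k 1≤k = 2 ℕ.^ (k ℕ.+ 1) , λ F odd E E-sphere →
  let open FiniteField F using (size)
      L = elemsOf F E
      L-sphere = All.map (λ {x} → E-sphere x) (all-filter (T? ∘ E) (space F d))
      L-distinct = Multiplicity.Distinct-filter (≈ᵥ-decSetoid F d) (T? ∘ E) (space F d) (Space.U-distinct F d)
      open SphereEstimates F L L-sphere L-distinct using (n; N; weighted-energy≤)
  in ZP.drop‿+≤+ (begin
    + (size ℕ.^ k ℕ.* energy F k E)
      ≡⟨ trans (ZP.pos-* (size ℕ.^ k) _) (cong₂ _*_ (pos-^ size k) (energy≡ΣN^k F odd k E L-sphere)) ⟩
    q F ^ k * Σ L (λ x → Σ L (λ x′ → N x x′ ^ k))
      ≤⟨ weighted-energy≤ k 1≤k ⟩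
    (+ 2) ^ suc k * (n ^ (k ℕ.+ 2) + q F ^ ((d ℕ.∸ 1) ℕ.+ k) * n ^ k)
      ≡⟨ pos-2^[k+1]*[m^[k+2]+s^e*m^k] k (card F E) size ((d ℕ.∸ 1) ℕ.+ k) ⟨
    + (2 ℕ.^ (k ℕ.+ 1) ℕ.* (card F E ℕ.^ (k ℕ.+ 2) ℕ.+ size ℕ.^ ((d ℕ.∸ 1) ℕ.+ k) ℕ.* card F E ℕ.^ k)) ∎)
  where open ZP.≤-Reasoning
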